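{- Let $G$ be a dihedral group of order $2n$, where $n=2m$ is even, and let $C$ be its cyclic subgroup of order $n$. Let $\Gamma=\mathrm{Cay}(G,S)$ be a distance-regular Cayley graph with intersection array $\{k,k-1,k-\mu;1,\mu,k\}$ with $\mu<k-1$, and let $H$ be the part (colour class) of this bipartite graph which contains the identity element. If $H\neq C$, then the Cayley graph $\Gamma_C=\mathrm{Cay}(C,S\cap C)$ is the incidence graph of a symmetric partial geometric design with parameters $(m,k_1,\alpha,\beta)$, and the set of distinct eigenvalues of $\Gamma_C$ is $\{\pm k_1,\pm\sqrt{k-\mu},0\}$, where $k_1=|S\cap C|$, $k_2=k-k_1$, $\alpha=\frac{\mu(2k_1-k_2)}{2}$, and $2k_1-1+\beta-\alpha=(k_1-k_2)^2=k-\mu$.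
   Context: For a finite group $G$ and an inverse-closed $S\subseteq G\setminus\{e\}$, $\mathrm{Cay}(G,S)$ has vertex set $G$, with $a\sim b$ iff $ab^{ -1}\in S$. A connected graph of diameter $d$ is distance-regular with intersection array $\{b_0,\dots,b_{d-1};c_1,\dots,c_d\}$ if for all vertices $x,y$ at distance $i$, the number of neighbours of $x$ at distance $i+1$ (resp. $i-1$) from $y$ is $b_i$ (resp. $c_i$). A symmetric partial geometric design with parameters $(n,k,\alpha,\beta)$ is an incidence structure with $n$ points and $n$ blocks, each block containing $k$ points and each point lying in $k$ blocks, such that for each point-block pair $(p,B)$ the number of incident point-block pairs $(p',B')$ with $p'\neq p$, $B'\neq B$, $p'\in B$ and $p\in B'$ equals $\beta$ if $p\in B$ and $\alpha$ if $p\notin B$. Its incidence graph is the bipartite graph on points and blocks with incidence as adjacency. Eigenvalues of a graph are those of its adjacency matrix. -}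

module Defs where

open import Data.Nat as ℕ using (ℕ; zero; suc; _+_; _*_; _∸_; _<_; _≤_; NonZero)
open import Data.Nat.Properties using (m*n≢0)
open import Data.Nat.DivMod using (_%_; m%n<n)
open import Data.Integer as ℤ using (ℤ; +_)
open import Data.Fin using (Fin; toℕ; fromℕ<)
open import Data.Bool using (Bool; true; false; _∧_; _∨_; _xor_; if_then_else_; not)
open import Data.List using (List; []; _∷_; length; filterᵇ; allFin; concatMap; foldr)
open import Data.Bool.ListAction using (any)
open import Data.Vec using (Vec; lookup)
open import Data.Product using (_×_; _,_; proj₁; proj₂; Σ; ∃)
open import Data.Sum using (_⊎_; inj₁; inj₂)
open import Relation.Binary.PropositionalEquality using (_≡_)
open import Relation.Nullary using (¬_)
open import Function.Bundles using (_↔_; Inverse)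
open import Data.List.Relation.Unary.All using (All)
import Data.List
import Data.Fin as Fin

count : {V : Set} → List V → (V → Bool) → ℕ
count vs p = length (filterᵇ p vs)

reach : {V : Set} → List V → (V → V → Bool) → (V → V → Bool) → ℕ → V → V → Bool
reach allV adj eq zero    x y = eq x y
reach allV adj eq (suc i) x y =
  reach allV adj eq i x y ∨ any (λ z → reach allV adj eq i x z ∧ adj z y) allV

distIs : {V : Set} → List V → (V → V → Bool) → (V → V → Bool) → ℕ → V → V → Bool
distIs allV adj eq zero    x y = eq x y
distIs allV adj eq (suc i) x y =
  reach allV adj eq (suc i) x y ∧ not (reach allV adj eq i x y)

-- Distance-regular graph of diameter d with intersection array
-- {b_0,...,b_{d-1}; c_1,...,c_d}; here  bs[i] = b_i  and  cs[i] = c_{i+1}.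
record IsDistanceRegular {V : Set} (allV : List V) (adj : V → V → Bool)
         (eq : V → V → Bool) (d : ℕ) (bs cs : Vec ℕ d) : Set where
  field
    connected-diam≤ : ∀ x y → Σ ℕ λ i → i ≤ d × distIs allV adj eq i x y ≡ true
    diam≥ : Σ V λ x → Σ V λ y → distIs allV adj eq d x y ≡ true
    b-ok : ∀ x y (i : Fin d) → distIs allV adj eq (toℕ i) x y ≡ true →
           count allV (λ z → adj x z ∧ distIs allV adj eq (suc (toℕ i)) z y) ≡ lookup bs i
    c-ok : ∀ x y (i : Fin d) → distIs allV adj eq (suc (toℕ i)) x y ≡ true →
           count allV (λ z → adj x z ∧ distIs allV adj eq (toℕ i) z y) ≡ lookup cs i

-- The dihedral group of order 2n, n = 2m, modelled as Fin n × Bool: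
-- (i , b) stands for r^i s^b.

module Dihedral (m : ℕ) .{{_ : NonZero m}} where

  n : ℕ
  n = 2 * m

  instance
    nz : NonZero n
    nz = m*n≢0 2 m

  modN : ℕ → Fin n
  modN x = fromℕ< (m%n<n x n)

  addF : Fin n → Fin n → Fin n
  addF i j = modN (toℕ i + toℕ j)

  negF : Fin n → Fin n
  negF i = modN (n ∸ toℕ i)

  D : Set
  D = Fin n × Bool

  e : D
  e = (modN 0 , false)

  -- (r^i s^b)(r^j s^c) = r^(i + (-1)^b j) s^(b+c)
  mul : D → D → D
  mul (i , b) (j , c) = (addF i (if b then negF j else j) , b xor c)

  inv : D → D
  inv (i , false) = (negF i , false)
  inv (i , true)  = (i , true)

  eqFin : Fin n → Fin n → Bool
  eqFin i j = ⌊ toℕ i ℕ.≟ toℕ j ⌋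
    where open import Relation.Nullary.Decidable using (⌊_⌋)

  eqBool : Bool → Bool → Bool
  eqBool b c = not (b xor c)

  eqD : D → D → Bool
  eqD (i , b) (j , c) = eqFin i j ∧ eqBool b c

  allD : List D
  allD = concatMap (λ i → (i , false) ∷ (i , true) ∷ []) (allFin n)

  inC : D → Bool
  inC (i , b) = not b

  cayAdj : (D → Bool) → D → D → Bool
  cayAdj S a b = S (mul a (inv b))

  -- Cay(C, S ∩ C), with C identified with Fin n via i ↦ r^i
  cayAdjC : (D → Bool) → Fin n → Fin n → Bool
  cayAdjC S i j = S (mul (i , false) (inv (j , false)))

-- Symmetric partial geometric designs with parameters (v, k, α, β):
-- points Fin v, blocks Fin v, incidence  I p B = true  iff  p ∈ B.

eqF : {v : ℕ} → Fin v → Fin v → Bool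
eqF i j = ⌊ toℕ i ℕ.≟ toℕ j ⌋
  where open import Relation.Nullary.Decidable using (⌊_⌋)

sumL : List ℕ → ℕ
sumL = foldr _+_ 0

flagCount : {v : ℕ} → (Fin v → Fin v → Bool) → Fin v → Fin v → ℕ
flagCount {v} I p B =
  sumL (Data.List.map (λ p' → count (allFin v) (λ B' →
          I p' B' ∧ not (eqF p' p) ∧ not (eqF B' B) ∧ I p' B ∧ I p B'))
        (allFin v))

record IsSymPGD (v k α β : ℕ) (I : Fin v → Fin v → Bool) : Set where
  field
    block-size : ∀ B → count (allFin v) (λ p → I p B) ≡ k
    point-deg  : ∀ p → count (allFin v) (λ B → I p B) ≡ k
    flag-count : ∀ p B → flagCount I p B ≡ (if I p B then β else α)

incAdj : {v : ℕ} → (Fin v → Fin v → Bool) → Fin v ⊎ Fin v → Fin v ⊎ Fin v → Bool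
incAdj I (inj₁ p) (inj₂ B) = I p B
incAdj I (inj₂ B) (inj₁ p) = I p B
incAdj I (inj₁ _) (inj₁ _) = false
incAdj I (inj₂ _) (inj₂ _) = false

IsIncidenceGraphOfSymPGD : {N : ℕ} → (Fin N → Fin N → Bool) → ℕ → ℕ → ℕ → ℕ → Set
IsIncidenceGraphOfSymPGD {N} adj v k α β =
  Σ (Fin v → Fin v → Bool) λ I → IsSymPGD v k α β I ×
  Σ (Fin N ↔ (Fin v ⊎ Fin v)) λ φ →
    ∀ x y → adj x y ≡ incAdj I (Inverse.to φ x) (Inverse.to φ y)

Mat : ℕ → Set
Mat N = Fin N → Fin N → ℤ

sumFin : (N : ℕ) → (Fin N → ℤ) → ℤ
sumFin zero    f = + 0
sumFin (suc N) f = f Fin.zero ℤ.+ sumFin N (λ i → f (Fin.suc i))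

adjMat : {N : ℕ} → (Fin N → Fin N → Bool) → Mat N
adjMat adj i j = if adj i j then + 1 else + 0

idMat : {N : ℕ} → Mat N
idMat i j = if eqF i j then + 1 else + 0

_⊗_ : {N : ℕ} → Mat N → Mat N → Mat N
_⊗_ {N} A B i j = sumFin N (λ l → A i l ℤ.* B l j)

shift : {N : ℕ} → Mat N → ℤ → Mat N
shift A λ' i j = A i j ℤ.- λ' ℤ.* idMat i j

IsEigenvalue : {N : ℕ} → Mat N → ℤ → Set
IsEigenvalue {N} A λ' = Σ (Fin N → ℤ) λ x → (Σ (Fin N) λ i → ¬ (x i ≡ + 0)) ×
  (∀ i → sumFin N (λ j → A i j ℤ.* x j) ≡ λ' ℤ.* x i)

prodShift : {N : ℕ} → Mat N → List ℤ → Mat N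
prodShift A []        = idMat
prodShift A (λ' ∷ L) = shift A λ' ⊗ prodShift A L

-- The set of distinct eigenvalues of the real symmetric matrix A equals
-- the set of elements of L: every element of L is an eigenvalue, and
-- every eigenvalue lies in L.  Since A is symmetric (diagonalisable), the
-- latter is expressed as  ∏_{λ ∈ L} (A - λ I) = 0.
EigenvalueSetIs : {N : ℕ} → Mat N → List ℤ → Set
EigenvalueSetIs A L = All (IsEigenvalue A) L × (∀ i j → prodShift A L i j ≡ + 0)

{-# OPTIONS --safe #-}
module Submission where

-- The intersection array forces a_i = k - b_i - c_i = 0, so Γ is bipartite, and as right
-- multiplications are automorphisms, the parity of the distance from e is a homomorphism
-- D → ℤ₂.  If H ≠ C it is odd on the rotation r, so S ∩ C consists of odd rotations and
-- Γ_C is bipartite with the even rotations as points and the odd ones as blocks.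
-- Counting common neighbours of e and g gives S² = (k - μ)e + μH in the group ring; its
-- rotation and reflection parts are convolution identities on ℤₙ for the indicators a, b
-- of S ∩ C and of S ∖ C (read as a subset of ℤₙ).  Summing them gives (k₁ - k₂)² = k - μ,
-- and convolving once more gives a³ = (k - μ)a + α 1_odd.  At p - B the left side counts
-- the paths p, B′, p′, B, which is the partial geometric condition; as an identity of
-- circulant matrices it gives A(A² - (k - μ))(A² - k₁²) = 0, and explicit eigenvectors
-- realise each of ±k₁, ±√(k - μ) and 0.

open import Defs
open import Algebra.Bundles using (AbelianGroup)
open import Algebra.Structures using (IsAbelianGroup)
open import Data.Bool using (Bool; true; false; _∧_; _∨_; _xor_; if_then_else_; not; T)
open import Data.Bool.Properties as BoolP using (xor-assoc; xor-identityʳ; xor-same; not-distribˡ-xor; not-involutive)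
open import Data.Empty using (⊥; ⊥-elim)
open import Data.Fin as F using (Fin; toℕ; fromℕ<)
open import Data.Fin.Properties as FinP using (toℕ-injective; toℕ-fromℕ<; toℕ<n)
import Data.Fin.Permutation as Perm
open import Data.Integer as ℤ using (ℤ; +_; -_; 0ℤ; 1ℤ)
open import Data.Integer.Properties as ℤP
open import Data.Integer.Tactic.RingSolver using (solve-∀)
open import Data.List as List using (List; []; _∷_; allFin; tabulate)
open import Data.List.Membership.Propositional using (_∈_)
open import Data.List.Relation.Unary.All using (All; []; _∷_)
open import Data.Nat as ℕ using (ℕ; zero; suc; NonZero; z≤n; s≤s)
import Data.Nat.DivMod as DivMod
import Data.Nat.Properties as ℕP
open import Data.Product using (_×_; _,_; proj₁; proj₂; Σ)
open import Data.Sum using (_⊎_; inj₁; inj₂; [_,_])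
open import Data.Vec using (Vec; lookup)
open import Function using (_∘_; id; _↔_; mk↔ₛ′)
open import Level using (0ℓ)
open import Relation.Binary using (tri<; tri≈; tri>)
open import Relation.Binary.PropositionalEquality
open import Relation.Nullary using (¬_; yes; no; Dec)

open import Algebra.Properties.CommutativeMonoid.Sum ℤP.+-0-commutativeMonoid
  using (sum; sum-syntax; sum-cong-≗; ∑-distrib-+; ∑-comm; ∑-permute; sum-replicate-zero)
open import Algebra.Properties.Semiring.Sum ℤP.+-*-semiring
  using (*-distribˡ-sum; *-distribʳ-sum)

open ≡-Reasoning

T-ext : ∀ {a b} → (T a → T b) → (T b → T a) → a ≡ b
T-ext {false} {false} _ _ = refl
T-ext {false} {true}  _ g = ⊥-elim (g _)
T-ext {true}  {false} f _ = ⊥-elim (f _)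
T-ext {true}  {true}  _ _ = refl

odd? : ℕ → Bool
odd? zero    = false
odd? (suc x) = not (odd? x)

odd?-+ : ∀ a b → odd? (a ℕ.+ b) ≡ odd? a xor odd? b
odd?-+ zero    b = refl
odd?-+ (suc a) b = trans (cong not (odd?-+ a b)) (not-distribˡ-xor (odd? a) (odd? b))

odd?-2* : ∀ k → odd? (2 ℕ.* k) ≡ false
odd?-2* k = begin
  odd? (k ℕ.+ (k ℕ.+ 0))       ≡⟨ odd?-+ k (k ℕ.+ 0) ⟩
  odd? k xor odd? (k ℕ.+ 0)    ≡⟨ cong (λ j → odd? k xor odd? j) (ℕP.+-identityʳ k) ⟩
  odd? k xor odd? k            ≡⟨ xor-same (odd? k) ⟩
  false                        ∎

%2-suc-suc : ∀ i → suc (suc i) DivMod.% 2 ≡ i DivMod.% 2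
%2-suc-suc i = trans (cong (DivMod._% 2) (ℕP.+-comm 2 i)) (DivMod.[m+n]%n≡m%n i 2)

odd?≡false⇒%2≡0 : ∀ i → odd? i ≡ false → i DivMod.% 2 ≡ 0
odd?≡false⇒%2≡0 zero          _    = refl
odd?≡false⇒%2≡0 (suc zero)    ()
odd?≡false⇒%2≡0 (suc (suc i)) even =
  trans (%2-suc-suc i) (odd?≡false⇒%2≡0 i (trans (sym (not-involutive (odd? i))) even))

%2≡0⇒odd?≡false : ∀ i → i DivMod.% 2 ≡ 0 → odd? i ≡ false
%2≡0⇒odd?≡false zero          _  = refl
%2≡0⇒odd?≡false (suc zero)    ()
%2≡0⇒odd?≡false (suc (suc i)) eq =
  trans (not-involutive (odd? i)) (%2≡0⇒odd?≡false i (trans (sym (%2-suc-suc i)) eq))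

module FinSums where

  open import Data.Integer using (_+_; _*_; _-_)

  -- stated with if_then_else_ so that adjMat and idMat of Defs are ⟦_⟧ definitionally
  ⟦_⟧ : Bool → ℤ
  ⟦ b ⟧ = if b then 1ℤ else 0ℤ

  ⟦∧⟧ : ∀ a b → ⟦ a ∧ b ⟧ ≡ ⟦ a ⟧ * ⟦ b ⟧
  ⟦∧⟧ true  b = sym (*-identityˡ ⟦ b ⟧)
  ⟦∧⟧ false b = refl

  ⟦not⟧ : ∀ a → ⟦ not a ⟧ ≡ 1ℤ - ⟦ a ⟧
  ⟦not⟧ true  = refl
  ⟦not⟧ false = refl

  ⟦⟧-idem : ∀ a → ⟦ a ⟧ * ⟦ a ⟧ ≡ ⟦ a ⟧
  ⟦⟧-idem true  = refl
  ⟦⟧-idem false = refl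

  0≤⟦⟧ : ∀ a → 0ℤ ℤ.≤ ⟦ a ⟧
  0≤⟦⟧ true  = ℤ.+≤+ z≤n
  0≤⟦⟧ false = ℤ.+≤+ z≤n

  ∑-zero : ∀ N → ∑[ i < N ] 0ℤ ≡ 0ℤ
  ∑-zero = sum-replicate-zero

  ∑-cong : ∀ {N} {f g : Fin N → ℤ} → (∀ i → f i ≡ g i) → ∑[ i < N ] f i ≡ ∑[ i < N ] g i
  ∑-cong = sum-cong-≗

  ∑-*ˡ : ∀ {N} c (f : Fin N → ℤ) → ∑[ i < N ] (c * f i) ≡ c * ∑[ i < N ] f i
  ∑-*ˡ c f = sym (*-distribˡ-sum c f)

  ∑-*ʳ : ∀ {N} c (f : Fin N → ℤ) → ∑[ i < N ] (f i * c) ≡ ∑[ i < N ] f i * c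
  ∑-*ʳ c f = sym (*-distribʳ-sum c f)

  ∑-const : ∀ N c → ∑[ i < N ] c ≡ + N * c
  ∑-const zero    c = sym (*-zeroˡ c)
  ∑-const (suc N) c = begin
    c + ∑[ i < N ] c   ≡⟨ cong (_+_ c) (∑-const N c) ⟩
    c + + N * c        ≡⟨ cong (_+ + N * c) (sym (*-identityˡ c)) ⟩
    1ℤ * c + + N * c   ≡⟨ sym (*-distribʳ-+ c 1ℤ (+ N)) ⟩
    + suc N * c        ∎

  sumFin≡∑ : ∀ N (f : Fin N → ℤ) → sumFin N f ≡ ∑[ i < N ] f i
  sumFin≡∑ zero    f = refl
  sumFin≡∑ (suc N) f = cong (_+_ (f F.zero)) (sumFin≡∑ N (f ∘ F.suc))

  ∑-reindex : ∀ {M N} (h : Fin N → ℤ) (f : Fin M → Fin N) (g : Fin N → Fin M) →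
              (∀ i → f (g i) ≡ i) → (∀ i → g (f i) ≡ i) →
              ∑[ i < N ] h i ≡ ∑[ i < M ] h (f i)
  ∑-reindex h f g fg gf = ∑-permute h (Perm.permutation f g fg gf)

  ∑-splitAt : ∀ M N (f : Fin (M ℕ.+ N) → ℤ) →
              ∑[ i < M ℕ.+ N ] f i ≡ ∑[ i < M ] f (i F.↑ˡ N) + ∑[ j < N ] f (M F.↑ʳ j)
  ∑-splitAt zero    N f = sym (+-identityˡ _)
  ∑-splitAt (suc M) N f =
    trans (cong (_+_ (f F.zero)) (∑-splitAt M N (f ∘ F.suc))) (sym (+-assoc (f F.zero) _ _))

  count-∷ : ∀ {A : Set} (x : A) xs p → + count (x ∷ xs) p ≡ ⟦ p x ⟧ + + count xs p
  count-∷ x xs p with p x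
  ... | true  = refl
  ... | false = sym (+-identityˡ _)

  count≡∑ : ∀ N (p : Fin N → Bool) → + count (allFin N) p ≡ ∑[ i < N ] ⟦ p i ⟧
  count≡∑ N p = go N id
    where
    go : ∀ {A : Set} M (t : Fin M → A) {q : A → Bool} →
         + count (tabulate t) q ≡ ∑[ i < M ] ⟦ q (t i) ⟧
    go zero    t     = refl
    go (suc M) t {q} =
      trans (count-∷ (t F.zero) _ q) (cong (_+_ ⟦ q (t F.zero) ⟧) (go M (t ∘ F.suc)))

  eqF-refl : ∀ {N} (i : Fin N) → eqF i i ≡ true
  eqF-refl i with toℕ i ℕ.≟ toℕ i
  ... | yes _  = refl
  ... | no i≢i = ⊥-elim (i≢i refl)

  eqF-≢ : ∀ {N} {i j : Fin N} → ¬ i ≡ j → eqF i j ≡ false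
  eqF-≢ {i = i} {j} i≢j with toℕ i ℕ.≟ toℕ j
  ... | yes i≡j = ⊥-elim (i≢j (toℕ-injective i≡j))
  ... | no _    = refl

  eqF⇒≡ : ∀ {N} (i j : Fin N) → eqF i j ≡ true → i ≡ j
  eqF⇒≡ i j eq with toℕ i ℕ.≟ toℕ j
  ... | yes i≡j = toℕ-injective i≡j

  eqF-suc : ∀ {N} (i j : Fin N) → eqF (F.suc i) (F.suc j) ≡ eqF i j
  eqF-suc i j with i FinP.≟ j
  ... | yes refl = trans (eqF-refl (F.suc i)) (sym (eqF-refl i))
  ... | no i≢j   = trans (eqF-≢ (i≢j ∘ FinP.suc-injective)) (sym (eqF-≢ i≢j))

  ∑-δ : ∀ {N} (i : Fin N) (f : Fin N → ℤ) → ∑[ j < N ] (⟦ eqF j i ⟧ * f j) ≡ f i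
  ∑-δ {suc N} F.zero f = begin
    ⟦ eqF {suc N} F.zero F.zero ⟧ * f F.zero + ∑[ j < N ] (⟦ eqF (F.suc j) F.zero ⟧ * f (F.suc j))
      ≡⟨ cong₂ (λ b s → ⟦ b ⟧ * f F.zero + s) (eqF-refl {suc N} F.zero)
               (trans (∑-cong (λ j → cong (λ b → ⟦ b ⟧ * f (F.suc j)) (eqF-≢ {i = F.suc j} {F.zero} λ ())))
                      (trans (∑-cong (λ j → *-zeroˡ (f (F.suc j)))) (∑-zero N))) ⟩
    1ℤ * f F.zero + 0ℤ  ≡⟨ trans (+-identityʳ _) (*-identityˡ _) ⟩
    f F.zero            ∎
  ∑-δ {suc N} (F.suc i) f = begin
    ⟦ eqF {suc N} F.zero (F.suc i) ⟧ * f F.zero + ∑[ j < N ] (⟦ eqF (F.suc j) (F.suc i) ⟧ * f (F.suc j))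
      ≡⟨ cong₂ (λ b s → ⟦ b ⟧ * f F.zero + s) (eqF-≢ {i = F.zero} {F.suc i} λ ())
               (∑-cong (λ j → cong (λ b → ⟦ b ⟧ * f (F.suc j)) (eqF-suc j i))) ⟩
    0ℤ + ∑[ j < N ] (⟦ eqF j i ⟧ * f (F.suc j))  ≡⟨ +-identityˡ _ ⟩
    ∑[ j < N ] (⟦ eqF j i ⟧ * f (F.suc j))       ≡⟨ ∑-δ i (f ∘ F.suc) ⟩
    f (F.suc i)                                  ∎

  ∑-distrib-- : ∀ {N} (f g : Fin N → ℤ) → ∑[ i < N ] (f i - g i) ≡ ∑[ i < N ] f i - ∑[ i < N ] g i
  ∑-distrib-- f g = begin
    sum (λ i → f i - g i)              ≡⟨ ∑-distrib-+ f (λ i → - g i) ⟩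
    sum f + sum (λ i → - g i)          ≡⟨ cong (_+_ (sum f)) (∑-cong (λ i → sym (-1*i≡-i (g i)))) ⟩
    sum f + sum (λ i → - 1ℤ * g i)     ≡⟨ cong (_+_ (sum f)) (∑-*ˡ (- 1ℤ) g) ⟩
    sum f + - 1ℤ * sum g               ≡⟨ cong (_+_ (sum f)) (-1*i≡-i (sum g)) ⟩
    sum f - sum g                      ∎

  ∑-except : ∀ {N} (i : Fin N) (f : Fin N → ℤ) → ∑[ j < N ] (⟦ not (eqF j i) ⟧ * f j) ≡ ∑[ j < N ] f j - f i
  ∑-except i f = begin
    ∑[ j < _ ] (⟦ not (eqF j i) ⟧ * f j)
      ≡⟨ ∑-cong (λ j → trans (cong (_* f j) (⟦not⟧ (eqF j i))) (expand ⟦ eqF j i ⟧ (f j))) ⟩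
    ∑[ j < _ ] (f j - ⟦ eqF j i ⟧ * f j)          ≡⟨ ∑-distrib-- f (λ j → ⟦ eqF j i ⟧ * f j) ⟩
    sum f - ∑[ j < _ ] (⟦ eqF j i ⟧ * f j)        ≡⟨ cong (_-_ (sum f)) (∑-δ i f) ⟩
    sum f - f i                                   ∎
    where
    expand : ∀ e x → (1ℤ - e) * x ≡ x - e * x
    expand = solve-∀

  ∑-mono-≤ : ∀ {N} {f g : Fin N → ℤ} → (∀ i → f i ℤ.≤ g i) → ∑[ i < N ] f i ℤ.≤ ∑[ i < N ] g i
  ∑-mono-≤ {zero}  f≤g = ℤP.≤-refl
  ∑-mono-≤ {suc N} f≤g = +-mono-≤ (f≤g F.zero) (∑-mono-≤ (f≤g ∘ F.suc))

  ∑≢0⇒∃≢0 : ∀ {N} (f : Fin N → ℤ) → ¬ ∑[ i < N ] f i ≡ 0ℤ → Σ (Fin N) λ i → ¬ f i ≡ 0ℤ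
  ∑≢0⇒∃≢0 {zero}  f ∑≢0 = ⊥-elim (∑≢0 refl)
  ∑≢0⇒∃≢0 {suc N} f ∑≢0 with f F.zero ℤ.≟ 0ℤ
  ... | no f0≢0 = F.zero , f0≢0
  ... | yes f0≡0 =
    let i , fi≢0 = ∑≢0⇒∃≢0 (f ∘ F.suc) (λ ∑≡0 → ∑≢0 (cong₂ _+_ f0≡0 ∑≡0)) in F.suc i , fi≢0

  ∑⟦⟧≢0⇒∃ : ∀ {N} (P : Fin N → Bool) → ¬ ∑[ i < N ] ⟦ P i ⟧ ≡ 0ℤ → Σ (Fin N) λ i → P i ≡ true
  ∑⟦⟧≢0⇒∃ P ∑≢0 with ∑≢0⇒∃≢0 (λ i → ⟦ P i ⟧) ∑≢0
  ... | i , ⟦Pi⟧≢0 with P i in Pi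
  ... | true  = i , Pi
  ... | false = ⊥-elim (⟦Pi⟧≢0 refl)

  ∑<∑⇒∃< : ∀ {N} (f g : Fin N → ℤ) → ∑[ i < N ] f i ℤ.< ∑[ i < N ] g i → Σ (Fin N) λ i → f i ℤ.< g i
  ∑<∑⇒∃< {zero}  f g (ℤ.+<+ ())
  ∑<∑⇒∃< {suc N} f g ∑f<∑g with f F.zero ℤ.<? g F.zero
  ... | yes f0<g0 = F.zero , f0<g0
  ... | no f0≮g0 =
    let i , fi<gi = ∑<∑⇒∃< (f ∘ F.suc) (g ∘ F.suc) (tail<tail (≮⇒≥ f0≮g0)) in F.suc i , fi<gi
    where
    tail<tail : g F.zero ℤ.≤ f F.zero → ∑[ i < N ] f (F.suc i) ℤ.< ∑[ i < N ] g (F.suc i)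
    tail<tail g0≤f0 with ∑[ i < N ] f (F.suc i) ℤ.<? ∑[ i < N ] g (F.suc i)
    ... | yes lt = lt
    ... | no ≮   = ⊥-elim (<⇒≱ ∑f<∑g (+-mono-≤ g0≤f0 (≮⇒≥ ≮)))

  sumL≡∑ : ∀ N (g : Fin N → ℕ) → + sumL (List.map g (allFin N)) ≡ ∑[ i < N ] (+ g i)
  sumL≡∑ N g = go N id
    where
    go : ∀ {A : Set} M (t : Fin M → A) {h : A → ℕ} →
         + sumL (List.map h (tabulate t)) ≡ ∑[ i < M ] (+ h (t i))
    go zero    t     = refl
    go (suc M) t {h} =
      trans (pos-+ (h (t F.zero)) _) (cong (_+_ (+ h (t F.zero))) (go M (t ∘ F.suc)))

module CyclicGroup (m : ℕ) .{{_ : NonZero m}} where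

  open Dihedral m
  open import Data.Nat.DivMod using (_%_; _/_; m%n%n≡m%n; %-distribˡ-+; m<n⇒m%n≡m; n%n≡0; m≡m%n+[m/n]*n)

  toℕ-modN : ∀ x → toℕ (modN x) ≡ x % n
  toℕ-modN x = toℕ-fromℕ< _

  modN-cong : ∀ {x y} → x % n ≡ y % n → modN x ≡ modN y
  modN-cong {x} {y} eq = toℕ-injective (trans (toℕ-modN x) (trans eq (sym (toℕ-modN y))))

  modN-toℕ : ∀ i → modN (toℕ i) ≡ i
  modN-toℕ i = toℕ-injective (trans (toℕ-modN (toℕ i)) (m<n⇒m%n≡m (toℕ<n i)))

  0ₙ : Fin n
  0ₙ = modN 0

  toℕ-0ₙ : toℕ 0ₙ ≡ 0
  toℕ-0ₙ = trans (toℕ-modN 0) (m<n⇒m%n≡m (ℕ.>-nonZero⁻¹ n))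

  %-absorbˡ-+ : ∀ a b → (a % n ℕ.+ b) % n ≡ (a ℕ.+ b) % n
  %-absorbˡ-+ a b = begin
    (a % n ℕ.+ b) % n          ≡⟨ %-distribˡ-+ (a % n) b n ⟩
    (a % n % n ℕ.+ b % n) % n  ≡⟨ cong (λ r → (r ℕ.+ b % n) % n) (m%n%n≡m%n a n) ⟩
    (a % n ℕ.+ b % n) % n      ≡⟨ sym (%-distribˡ-+ a b n) ⟩
    (a ℕ.+ b) % n              ∎

  %-absorbʳ-+ : ∀ a b → (a ℕ.+ b % n) % n ≡ (a ℕ.+ b) % n
  %-absorbʳ-+ a b = begin
    (a ℕ.+ b % n) % n  ≡⟨ cong (_% n) (ℕP.+-comm a (b % n)) ⟩
    (b % n ℕ.+ a) % n  ≡⟨ %-absorbˡ-+ b a ⟩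
    (b ℕ.+ a) % n      ≡⟨ cong (_% n) (ℕP.+-comm b a) ⟩
    (a ℕ.+ b) % n      ∎

  addF-comm : ∀ i j → addF i j ≡ addF j i
  addF-comm i j = cong modN (ℕP.+-comm (toℕ i) (toℕ j))

  addF-assoc : ∀ i j k → addF (addF i j) k ≡ addF i (addF j k)
  addF-assoc i j k = modN-cong (begin
    (toℕ (addF i j) ℕ.+ toℕ k) % n         ≡⟨ cong (λ r → (r ℕ.+ toℕ k) % n) (toℕ-modN _) ⟩
    ((toℕ i ℕ.+ toℕ j) % n ℕ.+ toℕ k) % n  ≡⟨ %-absorbˡ-+ _ _ ⟩
    (toℕ i ℕ.+ toℕ j ℕ.+ toℕ k) % n        ≡⟨ cong (_% n) (ℕP.+-assoc (toℕ i) _ _) ⟩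
    (toℕ i ℕ.+ (toℕ j ℕ.+ toℕ k)) % n      ≡⟨ sym (%-absorbʳ-+ _ _) ⟩
    (toℕ i ℕ.+ (toℕ j ℕ.+ toℕ k) % n) % n  ≡⟨ cong (λ r → (toℕ i ℕ.+ r) % n) (sym (toℕ-modN _)) ⟩
    (toℕ i ℕ.+ toℕ (addF j k)) % n         ∎)

  addF-identityʳ : ∀ i → addF i 0ₙ ≡ i
  addF-identityʳ i = begin
    modN (toℕ i ℕ.+ toℕ 0ₙ)  ≡⟨ cong (λ r → modN (toℕ i ℕ.+ r)) toℕ-0ₙ ⟩
    modN (toℕ i ℕ.+ 0)       ≡⟨ cong modN (ℕP.+-identityʳ (toℕ i)) ⟩
    modN (toℕ i)             ≡⟨ modN-toℕ i ⟩
    i                        ∎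

  addF-inverseʳ : ∀ i → addF i (negF i) ≡ 0ₙ
  addF-inverseʳ i = modN-cong (begin
    (toℕ i ℕ.+ toℕ (negF i)) % n    ≡⟨ cong (λ r → (toℕ i ℕ.+ r) % n) (toℕ-modN _) ⟩
    (toℕ i ℕ.+ (n ℕ.∸ toℕ i) % n) % n ≡⟨ %-absorbʳ-+ _ _ ⟩
    (toℕ i ℕ.+ (n ℕ.∸ toℕ i)) % n   ≡⟨ cong (_% n) (ℕP.m+[n∸m]≡n (ℕP.<⇒≤ (toℕ<n i))) ⟩
    n % n                           ≡⟨ n%n≡0 n ⟩
    0                               ≡⟨ sym (m<n⇒m%n≡m (ℕ.>-nonZero⁻¹ n)) ⟩
    0 % n                           ∎)

  addF-modN : ∀ a b → addF (modN a) (modN b) ≡ modN (a ℕ.+ b)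
  addF-modN a b = modN-cong (begin
    (toℕ (modN a) ℕ.+ toℕ (modN b)) % n  ≡⟨ cong₂ (λ u w → (u ℕ.+ w) % n) (toℕ-modN a) (toℕ-modN b) ⟩
    (a % n ℕ.+ b % n) % n                ≡⟨ sym (%-distribˡ-+ a b n) ⟩
    (a ℕ.+ b) % n                        ∎)

  isAbelianGroup : IsAbelianGroup _≡_ addF 0ₙ negF
  isAbelianGroup = record
    { isGroup = record
      { isMonoid = record
        { isSemigroup = record
          { isMagma = record { isEquivalence = isEquivalence ; ∙-cong = cong₂ addF }
          ; assoc = addF-assoc }
        ; identity = (λ i → trans (addF-comm 0ₙ i) (addF-identityʳ i)) , addF-identityʳ }
      ; inverse = (λ i → trans (addF-comm (negF i) i) (addF-inverseʳ i)) , addF-inverseʳ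
      ; ⁻¹-cong = cong negF }
    ; comm = addF-comm }

  ℤₙ : AbelianGroup 0ℓ 0ℓ
  ℤₙ = record { isAbelianGroup = isAbelianGroup }

  open AbelianGroup ℤₙ public using ()
    renaming (_-_ to _⊟_; identityˡ to addF-identityˡ; inverseˡ to addF-inverseˡ)
  open import Algebra.Properties.AbelianGroup ℤₙ public
    using (⁻¹-involutive; ⁻¹-anti-homo‿-; ⁻¹-∙-comm; ε⁻¹≈ε; x∙y⁻¹≈ε⇒x≈y; //-rightDividesˡ; //-rightDividesʳ)

  addF-interchange : ∀ a b c d → addF (addF a b) (addF c d) ≡ addF (addF a c) (addF b d)
  addF-interchange a b c d = begin
    addF (addF a b) (addF c d)  ≡⟨ addF-assoc a b _ ⟩
    addF a (addF b (addF c d))  ≡⟨ cong (addF a) (sym (addF-assoc b c d)) ⟩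
    addF a (addF (addF b c) d)  ≡⟨ cong (λ x → addF a (addF x d)) (addF-comm b c) ⟩
    addF a (addF (addF c b) d)  ≡⟨ cong (addF a) (addF-assoc c b d) ⟩
    addF a (addF c (addF b d))  ≡⟨ sym (addF-assoc a c _) ⟩
    addF (addF a c) (addF b d)  ∎

  ⊟-cancelʳ : ∀ x y t → addF x t ⊟ addF y t ≡ x ⊟ y
  ⊟-cancelʳ x y t = begin
    addF (addF x t) (negF (addF y t))         ≡⟨ cong (addF (addF x t)) (sym (⁻¹-∙-comm y t)) ⟩
    addF (addF x t) (addF (negF y) (negF t))  ≡⟨ addF-interchange x t (negF y) (negF t) ⟩
    addF (x ⊟ y) (t ⊟ t)                      ≡⟨ cong (addF (x ⊟ y)) (addF-inverseʳ t) ⟩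
    addF (x ⊟ y) 0ₙ                           ≡⟨ addF-identityʳ _ ⟩
    x ⊟ y                                     ∎

  ⊟-⊟-cancelʳ : ∀ x w v → (x ⊟ v) ⊟ (w ⊟ v) ≡ x ⊟ w
  ⊟-⊟-cancelʳ x w v = ⊟-cancelʳ x w (negF v)

  ⊟-involutive : ∀ x w → x ⊟ (x ⊟ w) ≡ w
  ⊟-involutive x w = begin
    addF x (negF (x ⊟ w))  ≡⟨ cong (addF x) (⁻¹-anti-homo‿- x w) ⟩
    addF x (w ⊟ x)         ≡⟨ addF-comm x _ ⟩
    addF (w ⊟ x) x         ≡⟨ //-rightDividesˡ x w ⟩
    w                      ∎

  ⊟-0ₙ : ∀ x → x ⊟ 0ₙ ≡ x
  ⊟-0ₙ x = trans (cong (addF x) ε⁻¹≈ε) (addF-identityʳ x)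

  -- odd? descends to ℤₙ because n is even
  odd?-%n : ∀ x → odd? (x % n) ≡ odd? x
  odd?-%n x = sym (begin
    odd? x                                          ≡⟨ cong odd? (m≡m%n+[m/n]*n x n) ⟩
    odd? (x % n ℕ.+ x / n ℕ.* n)                    ≡⟨ odd?-+ (x % n) _ ⟩
    odd? (x % n) xor odd? (x / n ℕ.* (2 ℕ.* m))     ≡⟨ cong (λ j → odd? (x % n) xor odd? j) (ℕP.*-comm (x / n) n) ⟩
    odd? (x % n) xor odd? (2 ℕ.* m ℕ.* (x / n))     ≡⟨ cong (λ j → odd? (x % n) xor odd? j) (ℕP.*-assoc 2 m (x / n)) ⟩
    odd? (x % n) xor odd? (2 ℕ.* (m ℕ.* (x / n)))   ≡⟨ cong (odd? (x % n) xor_) (odd?-2* (m ℕ.* (x / n))) ⟩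
    odd? (x % n) xor false                          ≡⟨ xor-identityʳ _ ⟩
    odd? (x % n)                                    ∎)

  parF : Fin n → Bool
  parF i = odd? (toℕ i)

  parF-modN : ∀ x → parF (modN x) ≡ odd? x
  parF-modN x = trans (cong odd? (toℕ-modN x)) (odd?-%n x)

  parF-addF : ∀ i j → parF (addF i j) ≡ parF i xor parF j
  parF-addF i j = trans (parF-modN _) (odd?-+ (toℕ i) (toℕ j))

  parF-0ₙ : parF 0ₙ ≡ false
  parF-0ₙ = parF-modN 0

  parF-negF : ∀ i → parF (negF i) ≡ parF i
  parF-negF i = begin
    parF (negF i)                          ≡⟨ sym (xor-identityʳ _) ⟩
    parF (negF i) xor false                ≡⟨ cong (parF (negF i) xor_) (sym (xor-same (parF i))) ⟩
    parF (negF i) xor (parF i xor parF i)  ≡⟨ sym (xor-assoc (parF (negF i)) _ _) ⟩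
    (parF (negF i) xor parF i) xor parF i  ≡⟨ cong (_xor parF i) (sym (parF-addF (negF i) i)) ⟩
    parF (addF (negF i) i) xor parF i      ≡⟨ cong (λ j → parF j xor parF i) (addF-inverseˡ i) ⟩
    parF 0ₙ xor parF i                     ≡⟨ cong (_xor parF i) parF-0ₙ ⟩
    parF i                                 ∎

  parF-⊟ : ∀ i j → parF (i ⊟ j) ≡ parF i xor parF j
  parF-⊟ i j = trans (parF-addF i (negF j)) (cong (parF i xor_) (parF-negF j))

module Convolution (m : ℕ) .{{_ : NonZero m}} where

  open import Data.Integer using (_+_; _*_; _-_)
  open FinSums

  open Dihedral m
  open CyclicGroup m

  Fun : Set
  Fun = Fin n → ℤ

  infixl 7 _⋆_

  _⋆_ : Fun → Fun → Fun
  (f ⋆ g) x = ∑[ w < n ] (f (x ⊟ w) * g w)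

  δ : Fun
  δ y = ⟦ eqF y 0ₙ ⟧

  ∑-translate : ∀ (f : Fun) t → sum f ≡ ∑[ i < n ] f (addF i t)
  ∑-translate f t = ∑-reindex f (λ i → addF i t) (_⊟ t) (//-rightDividesˡ t) (//-rightDividesʳ t)

  ∑-negate : ∀ (f : Fun) → sum f ≡ ∑[ i < n ] f (negF i)
  ∑-negate f = ∑-reindex f negF negF ⁻¹-involutive ⁻¹-involutive

  ∑-reflect : ∀ (f : Fun) x → sum f ≡ ∑[ w < n ] f (x ⊟ w)
  ∑-reflect f x = ∑-reindex f (x ⊟_) (x ⊟_) (⊟-involutive x) (⊟-involutive x)

  ⋆-cong : ∀ {f f′ g g′ : Fun} → (∀ x → f x ≡ f′ x) → (∀ x → g x ≡ g′ x) → ∀ x → (f ⋆ g) x ≡ (f′ ⋆ g′) x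
  ⋆-cong f≗f′ g≗g′ x = ∑-cong (λ w → cong₂ _*_ (f≗f′ (x ⊟ w)) (g≗g′ w))

  ⋆-congʳ : ∀ f {g g′ : Fun} → (∀ x → g x ≡ g′ x) → ∀ x → (f ⋆ g) x ≡ (f ⋆ g′) x
  ⋆-congʳ f = ⋆-cong {f} (λ _ → refl)

  ⋆-comm : ∀ f g x → (f ⋆ g) x ≡ (g ⋆ f) x
  ⋆-comm f g x = begin
    ∑[ w < n ] (f (x ⊟ w) * g w)                    ≡⟨ ∑-reflect _ x ⟩
    ∑[ w < n ] (f (x ⊟ (x ⊟ w)) * g (x ⊟ w))        ≡⟨ ∑-cong (λ w → cong (λ u → f u * g (x ⊟ w)) (⊟-involutive x w)) ⟩
    ∑[ w < n ] (f w * g (x ⊟ w))                    ≡⟨ ∑-cong (λ w → *-comm (f w) _) ⟩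
    ∑[ w < n ] (g (x ⊟ w) * f w)                    ∎

  ∑-circulant : ∀ f g i j → ∑[ l < n ] (f (i ⊟ l) * g (l ⊟ j)) ≡ (f ⋆ g) (i ⊟ j)
  ∑-circulant f g i j = sym (begin
    ∑[ w < n ] (f ((i ⊟ j) ⊟ w) * g w)                  ≡⟨ ∑-translate _ (negF j) ⟩
    ∑[ l < n ] (f ((i ⊟ j) ⊟ (l ⊟ j)) * g (l ⊟ j))
      ≡⟨ ∑-cong (λ l → cong (λ u → f u * g (l ⊟ j)) (⊟-⊟-cancelʳ i l j)) ⟩
    ∑[ l < n ] (f (i ⊟ l) * g (l ⊟ j))                  ∎)

  ⋆-assoc : ∀ f g h x → ((f ⋆ g) ⋆ h) x ≡ (f ⋆ (g ⋆ h)) x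
  ⋆-assoc f g h x = begin
    ∑[ v < n ] (∑[ u < n ] (f ((x ⊟ v) ⊟ u) * g u) * h v)
      ≡⟨ ∑-cong (λ v → sym (∑-*ʳ (h v) (λ u → f ((x ⊟ v) ⊟ u) * g u))) ⟩
    ∑[ v < n ] ∑[ u < n ] (f ((x ⊟ v) ⊟ u) * g u * h v)
      ≡⟨ ∑-cong (λ v → ∑-translate _ (negF v)) ⟩
    ∑[ v < n ] ∑[ w < n ] (f ((x ⊟ v) ⊟ (w ⊟ v)) * g (w ⊟ v) * h v)
      ≡⟨ ∑-cong (λ v → ∑-cong (λ w → cong (λ u → f u * g (w ⊟ v) * h v) (⊟-⊟-cancelʳ x w v))) ⟩
    ∑[ v < n ] ∑[ w < n ] (f (x ⊟ w) * g (w ⊟ v) * h v)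
      ≡⟨ ∑-comm (λ v w → f (x ⊟ w) * g (w ⊟ v) * h v) ⟩
    ∑[ w < n ] ∑[ v < n ] (f (x ⊟ w) * g (w ⊟ v) * h v)
      ≡⟨ ∑-cong (λ w → trans (∑-cong (λ v → *-assoc (f (x ⊟ w)) (g (w ⊟ v)) (h v)))
                              (∑-*ˡ (f (x ⊟ w)) (λ v → g (w ⊟ v) * h v))) ⟩
    ∑[ w < n ] (f (x ⊟ w) * ∑[ v < n ] (g (w ⊟ v) * h v))    ∎

  ⋆-linearʳ : ∀ f g h c d x → (f ⋆ (λ y → c * g y + d * h y)) x ≡ c * (f ⋆ g) x + d * (f ⋆ h) x
  ⋆-linearʳ f g h c d x = begin
    ∑[ w < n ] (f (x ⊟ w) * (c * g w + d * h w))
      ≡⟨ ∑-cong (λ w → distrib (f (x ⊟ w)) (g w) (h w) c d) ⟩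
    ∑[ w < n ] (c * (f (x ⊟ w) * g w) + d * (f (x ⊟ w) * h w))
      ≡⟨ ∑-distrib-+ (λ w → c * (f (x ⊟ w) * g w)) (λ w → d * (f (x ⊟ w) * h w)) ⟩
    ∑[ w < n ] (c * (f (x ⊟ w) * g w)) + ∑[ w < n ] (d * (f (x ⊟ w) * h w))
      ≡⟨ cong₂ _+_ (∑-*ˡ c (λ w → f (x ⊟ w) * g w)) (∑-*ˡ d (λ w → f (x ⊟ w) * h w)) ⟩
    c * (f ⋆ g) x + d * (f ⋆ h) x ∎
    where
    distrib : ∀ a g h c d → a * (c * g + d * h) ≡ c * (a * g) + d * (a * h)
    distrib = solve-∀

  ⋆-distribˡ : ∀ f g h x → (f ⋆ (λ y → g y + h y)) x ≡ (f ⋆ g) x + (f ⋆ h) x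
  ⋆-distribˡ f g h x = trans (∑-cong (λ w → *-distribˡ-+ (f (x ⊟ w)) (g w) (h w)))
                             (∑-distrib-+ (λ w → f (x ⊟ w) * g w) (λ w → f (x ⊟ w) * h w))

  ⋆-scaleʳ : ∀ f g c x → (f ⋆ (λ y → c * g y)) x ≡ c * (f ⋆ g) x
  ⋆-scaleʳ f g c x = trans (∑-cong (λ w → swap (f (x ⊟ w)) c (g w))) (∑-*ˡ c (λ w → f (x ⊟ w) * g w))
    where
    swap : ∀ a c g → a * (c * g) ≡ c * (a * g)
    swap = solve-∀

  ⋆-scaleˡ : ∀ c f g x → ((λ y → c * f y) ⋆ g) x ≡ c * (f ⋆ g) x
  ⋆-scaleˡ c f g x = trans (∑-cong (λ w → *-assoc c (f (x ⊟ w)) (g w))) (∑-*ˡ c (λ w → f (x ⊟ w) * g w))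

  ⋆-distribʳ : ∀ f g h x → ((λ y → f y + g y) ⋆ h) x ≡ (f ⋆ h) x + (g ⋆ h) x
  ⋆-distribʳ f g h x = trans (∑-cong (λ w → *-distribʳ-+ (h w) (f (x ⊟ w)) (g (x ⊟ w))))
                         (∑-distrib-+ (λ w → f (x ⊟ w) * h w) (λ w → g (x ⊟ w) * h w))

  δ-⊟ : ∀ i j → ⟦ eqF i j ⟧ ≡ δ (i ⊟ j)
  δ-⊟ i j with i FinP.≟ j
  ... | yes refl = begin
    ⟦ eqF i i ⟧       ≡⟨ cong ⟦_⟧ (eqF-refl i) ⟩
    1ℤ                ≡⟨ cong ⟦_⟧ (sym (eqF-refl 0ₙ)) ⟩
    ⟦ eqF 0ₙ 0ₙ ⟧     ≡⟨ cong (λ u → ⟦ eqF u 0ₙ ⟧) (sym (addF-inverseʳ i)) ⟩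
    δ (i ⊟ i)         ∎
  ... | no i≢j  = trans (cong ⟦_⟧ (eqF-≢ i≢j)) (sym (cong ⟦_⟧ (eqF-≢ (i≢j ∘ x∙y⁻¹≈ε⇒x≈y i j))))

  ⋆-identityʳ : ∀ f x → (f ⋆ δ) x ≡ f x
  ⋆-identityʳ f x = begin
    ∑[ w < n ] (f (x ⊟ w) * δ w)  ≡⟨ ∑-cong (λ w → *-comm (f (x ⊟ w)) (δ w)) ⟩
    ∑[ w < n ] (δ w * f (x ⊟ w))  ≡⟨ ∑-δ 0ₙ _ ⟩
    f (x ⊟ 0ₙ)                    ≡⟨ cong f (⊟-0ₙ x) ⟩
    f x                           ∎

  ⋆-identityˡ : ∀ f x → (δ ⋆ f) x ≡ f x
  ⋆-identityˡ f x = trans (⋆-comm δ f x) (⋆-identityʳ f x)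

  ∑-δₙ : sum δ ≡ 1ℤ
  ∑-δₙ = trans (∑-cong (λ y → sym (*-identityʳ (δ y)))) (∑-δ 0ₙ (λ _ → 1ℤ))

  ∑-⋆ : ∀ f g → sum (f ⋆ g) ≡ sum f * sum g
  ∑-⋆ f g = begin
    ∑[ x < n ] ∑[ w < n ] (f (x ⊟ w) * g w)  ≡⟨ ∑-comm (λ x w → f (x ⊟ w) * g w) ⟩
    ∑[ w < n ] ∑[ x < n ] (f (x ⊟ w) * g w)  ≡⟨ ∑-cong (λ w → ∑-*ʳ (g w) (λ x → f (x ⊟ w))) ⟩
    ∑[ w < n ] (∑[ x < n ] f (x ⊟ w) * g w)  ≡⟨ ∑-cong (λ w → cong (_* g w) (sym (∑-translate f (negF w)))) ⟩
    ∑[ w < n ] (sum f * g w)                 ≡⟨ ∑-*ˡ (sum f) g ⟩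
    sum f * sum g                            ∎

  ⋆-const : ∀ f c x → (f ⋆ (λ _ → c)) x ≡ sum f * c
  ⋆-const f c x = trans (∑-*ʳ c (λ w → f (x ⊟ w))) (cong (_* c) (sym (∑-reflect f x)))

  ⋆-eigen-√ : ∀ f v t → (∀ x → (f ⋆ (f ⋆ v)) x ≡ t * t * v x) →
              ∀ x → (f ⋆ (λ y → 1ℤ * (f ⋆ v) y + t * v y)) x ≡ t * (1ℤ * (f ⋆ v) x + t * v x)
  ⋆-eigen-√ f v t f²v≡ x = begin
    (f ⋆ (λ y → 1ℤ * (f ⋆ v) y + t * v y)) x      ≡⟨ ⋆-linearʳ f (f ⋆ v) v 1ℤ t x ⟩
    1ℤ * (f ⋆ (f ⋆ v)) x + t * (f ⋆ v) x          ≡⟨ cong (λ u → 1ℤ * u + t * (f ⋆ v) x) (f²v≡ x) ⟩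
    1ℤ * (t * t * v x) + t * (f ⋆ v) x            ≡⟨ factor t (v x) ((f ⋆ v) x) ⟩
    t * (1ℤ * (f ⋆ v) x + t * v x)                ∎
    where
    factor : ∀ t v w → 1ℤ * (t * t * v) + t * w ≡ t * (1ℤ * w + t * v)
    factor = solve-∀

  shift-⋆ : ∀ f l g x → ((λ y → f y - l * δ y) ⋆ g) x ≡ (f ⋆ g) x - l * g x
  shift-⋆ f l g x = begin
    ((λ y → f y - l * δ y) ⋆ g) x               ≡⟨ ⋆-distribʳ f (λ y → - (l * δ y)) g x ⟩
    (f ⋆ g) x + ((λ y → - (l * δ y)) ⋆ g) x
      ≡⟨ cong (_+_ ((f ⋆ g) x)) (⋆-cong (λ y → neg-distribˡ-* l (δ y)) (λ _ → refl) x) ⟩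
    (f ⋆ g) x + ((λ y → - l * δ y) ⋆ g) x       ≡⟨ cong (_+_ ((f ⋆ g) x)) (⋆-scaleˡ (- l) δ g x) ⟩
    (f ⋆ g) x + - l * (δ ⋆ g) x                 ≡⟨ cong (λ t → (f ⋆ g) x + - l * t) (⋆-identityˡ g x) ⟩
    (f ⋆ g) x + - l * g x                       ≡⟨ cong (_+_ ((f ⋆ g) x)) (sym (neg-distribˡ-* l (g x))) ⟩
    (f ⋆ g) x - l * g x                         ∎

  -- ∏_{l ∈ L} (f - l δ) in the group ring, i.e. the circulant counterpart of prodShift
  shiftProduct : Fun → List ℤ → Fun
  shiftProduct f []      = δ
  shiftProduct f (l ∷ L) = (λ y → f y - l * δ y) ⋆ shiftProduct f L

  prodShift-circulant : ∀ (M : Mat n) f → (∀ i j → M i j ≡ f (i ⊟ j)) →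
                        ∀ L i j → prodShift M L i j ≡ shiftProduct f L (i ⊟ j)
  prodShift-circulant M f M≡ []      i j = δ-⊟ i j
  prodShift-circulant M f M≡ (l ∷ L) i j = begin
    sumFin n (λ q → shift M l i q * prodShift M L q j)
      ≡⟨ sumFin≡∑ n _ ⟩
    ∑[ q < n ] (shift M l i q * prodShift M L q j)
      ≡⟨ ∑-cong (λ q → cong₂ _*_ (cong₂ (λ u w → u - l * w) (M≡ i q) (δ-⊟ i q))
                                  (prodShift-circulant M f M≡ L q j)) ⟩
    ∑[ q < n ] ((f (i ⊟ q) - l * δ (i ⊟ q)) * shiftProduct f L (q ⊟ j))
      ≡⟨ ∑-circulant (λ y → f y - l * δ y) (shiftProduct f L) i j ⟩
    shiftProduct f (l ∷ L) (i ⊟ j) ∎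

  χ : Bool → Fun
  χ c y = ⟦ not (parF y xor c) ⟧

  χ-complement : ∀ x → χ false x + χ true x ≡ 1ℤ
  χ-complement x with parF x
  ... | true  = refl
  ... | false = refl

  SupportedIn : Bool → Fun → Set
  SupportedIn p f = ∀ u → parF u ≡ not p → f u ≡ 0ℤ

  ⋆-χ : ∀ {p} f c → SupportedIn p f → ∀ x → (f ⋆ χ c) x ≡ sum f * χ (p xor c) x
  ⋆-χ {p} f c supp x = begin
    (f ⋆ χ c) x                      ≡⟨ ⋆-comm f (χ c) x ⟩
    ∑[ w < n ] (χ c (x ⊟ w) * f w)   ≡⟨ ∑-cong term ⟩
    ∑[ w < n ] (χ (p xor c) x * f w) ≡⟨ ∑-*ˡ (χ (p xor c) x) f ⟩
    χ (p xor c) x * sum f            ≡⟨ *-comm (χ (p xor c) x) _ ⟩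
    sum f * χ (p xor c) x            ∎
    where
    term : ∀ w → χ c (x ⊟ w) * f w ≡ χ (p xor c) x * f w
    term w with parF w Data.Bool.≟ p
    ... | yes pw≡p = cong (λ b → ⟦ not b ⟧ * f w) (begin
      parF (x ⊟ w) xor c           ≡⟨ cong (_xor c) (parF-⊟ x w) ⟩
      (parF x xor parF w) xor c    ≡⟨ cong (λ b → (parF x xor b) xor c) pw≡p ⟩
      (parF x xor p) xor c         ≡⟨ xor-assoc (parF x) p c ⟩
      parF x xor (p xor c)         ∎)
    ... | no pw≢p = begin
      χ c (x ⊟ w) * f w            ≡⟨ cong (χ c (x ⊟ w) *_) fw≡0 ⟩
      χ c (x ⊟ w) * 0ℤ             ≡⟨ *-zeroʳ (χ c (x ⊟ w)) ⟩
      0ℤ                           ≡⟨ sym (*-zeroʳ (χ (p xor c) x)) ⟩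
      χ (p xor c) x * 0ℤ           ≡⟨ cong (χ (p xor c) x *_) (sym fw≡0) ⟩
      χ (p xor c) x * f w          ∎
      where
      fw≡0 : f w ≡ 0ℤ
      fw≡0 = supp w (BoolP.¬-not pw≢p)

  ⋆-supportedIn : ∀ {p q} f g → SupportedIn p f → SupportedIn q g → SupportedIn (p xor q) (f ⋆ g)
  ⋆-supportedIn {p} {q} f g suppf suppg x px = trans (∑-cong term) (∑-zero n)
    where
    term : ∀ w → f (x ⊟ w) * g w ≡ 0ℤ
    term w with parF w Data.Bool.≟ q
    ... | no pw≢q  = trans (cong (f (x ⊟ w) *_) (suppg w (BoolP.¬-not pw≢q))) (*-zeroʳ (f (x ⊟ w)))
    ... | yes pw≡q = trans (cong (_* g w) (suppf (x ⊟ w) (begin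
      parF (x ⊟ w)                ≡⟨ parF-⊟ x w ⟩
      parF x xor parF w           ≡⟨ cong₂ _xor_ px pw≡q ⟩
      not (p xor q) xor q         ≡⟨ cong (_xor q) (not-distribˡ-xor p q) ⟩
      (not p xor q) xor q         ≡⟨ xor-assoc (not p) q q ⟩
      not p xor (q xor q)         ≡⟨ cong (not p xor_) (xor-same q) ⟩
      not p xor false             ≡⟨ xor-identityʳ (not p) ⟩
      not p                       ∎))) (*-zeroˡ (g w))

module ParityClasses (m : ℕ) .{{_ : NonZero m}} where

  open import Data.Integer using (_+_; _*_; _-_)
  open FinSums

  open Dihedral m
  open CyclicGroup m
  open Convolution m
  open import Data.Nat.DivMod using (m<n⇒m%n≡m)
  open import Data.Sum using ([_,_]′)

  ⌊/2⌋-spec : ∀ x → x ≡ (if odd? x then suc (2 ℕ.* ℕ.⌊ x /2⌋) else 2 ℕ.* ℕ.⌊ x /2⌋)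
  ⌊/2⌋-spec zero          = refl
  ⌊/2⌋-spec (suc zero)    = refl
  ⌊/2⌋-spec (suc (suc x)) with odd? x | ⌊/2⌋-spec x
  ... | true  | x≡ = cong (suc ∘ suc) (trans x≡ (sym (ℕP.+-suc ℕ.⌊ x /2⌋ _)))
  ... | false | x≡ = cong suc (trans (cong suc x≡) (sym (ℕP.+-suc ℕ.⌊ x /2⌋ _)))

  ⌊2*p/2⌋≡p : ∀ p → ℕ.⌊ 2 ℕ.* p /2⌋ ≡ p
  ⌊2*p/2⌋≡p zero    = refl
  ⌊2*p/2⌋≡p (suc p) = trans (cong ℕ.⌊_/2⌋ (ℕP.*-suc 2 p)) (cong suc (⌊2*p/2⌋≡p p))

  ⌊1+2*p/2⌋≡p : ∀ p → ℕ.⌊ suc (2 ℕ.* p) /2⌋ ≡ p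
  ⌊1+2*p/2⌋≡p zero    = refl
  ⌊1+2*p/2⌋≡p (suc p) = trans (cong (λ x → ℕ.⌊ suc x /2⌋) (ℕP.*-suc 2 p)) (cong suc (⌊1+2*p/2⌋≡p p))

  ⌊/2⌋-< : ∀ x → x ℕ.< n → ℕ.⌊ x /2⌋ ℕ.< m
  ⌊/2⌋-< x x<n with odd? x | ⌊/2⌋-spec x
  ... | true  | x≡ = ℕP.*-cancelˡ-< 2 _ m (ℕP.<-trans (ℕP.n<1+n _) (subst (ℕ._< n) x≡ x<n))
  ... | false | x≡ = ℕP.*-cancelˡ-< 2 _ m (subst (ℕ._< n) x≡ x<n)

  1+2*p<n : ∀ (p : Fin m) → suc (2 ℕ.* toℕ p) ℕ.< n
  1+2*p<n p = subst (ℕ._≤ n) (ℕP.*-suc 2 (toℕ p)) (ℕP.*-monoʳ-≤ 2 (toℕ<n p))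

  evenₙ oddₙ : Fin m → Fin n
  evenₙ p = modN (2 ℕ.* toℕ p)
  oddₙ  p = modN (suc (2 ℕ.* toℕ p))

  toℕ-evenₙ : ∀ p → toℕ (evenₙ p) ≡ 2 ℕ.* toℕ p
  toℕ-evenₙ p = trans (toℕ-modN _) (m<n⇒m%n≡m (ℕP.<-trans (ℕP.n<1+n _) (1+2*p<n p)))

  toℕ-oddₙ : ∀ p → toℕ (oddₙ p) ≡ suc (2 ℕ.* toℕ p)
  toℕ-oddₙ p = trans (toℕ-modN _) (m<n⇒m%n≡m (1+2*p<n p))

  parF-evenₙ : ∀ p → parF (evenₙ p) ≡ false
  parF-evenₙ p = trans (cong odd? (toℕ-evenₙ p)) (odd?-2* (toℕ p))

  parF-oddₙ : ∀ p → parF (oddₙ p) ≡ true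
  parF-oddₙ p = trans (cong odd? (toℕ-oddₙ p)) (cong not (odd?-2* (toℕ p)))

  half : Fin n → Fin m
  half x = fromℕ< (⌊/2⌋-< (toℕ x) (toℕ<n x))

  toℕ-half : ∀ x → toℕ (half x) ≡ ℕ.⌊ toℕ x /2⌋
  toℕ-half x = toℕ-fromℕ< _

  halve : Fin n → Fin m ⊎ Fin m
  halve x = if parF x then inj₂ (half x) else inj₁ (half x)

  unhalve : Fin m ⊎ Fin m → Fin n
  unhalve = [ evenₙ , oddₙ ]′

  unhalve-halve : ∀ x → unhalve (halve x) ≡ x
  unhalve-halve x with parF x | ⌊/2⌋-spec (toℕ x)
  ... | true  | x≡ = toℕ-injective (begin
    toℕ (oddₙ (half x))          ≡⟨ toℕ-oddₙ (half x) ⟩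
    suc (2 ℕ.* toℕ (half x))     ≡⟨ cong (λ h → suc (2 ℕ.* h)) (toℕ-half x) ⟩
    suc (2 ℕ.* ℕ.⌊ toℕ x /2⌋)    ≡⟨ sym x≡ ⟩
    toℕ x                        ∎)
  ... | false | x≡ = toℕ-injective (begin
    toℕ (evenₙ (half x))         ≡⟨ toℕ-evenₙ (half x) ⟩
    2 ℕ.* toℕ (half x)           ≡⟨ cong (2 ℕ.*_) (toℕ-half x) ⟩
    2 ℕ.* ℕ.⌊ toℕ x /2⌋          ≡⟨ sym x≡ ⟩
    toℕ x                        ∎)

  halve-even : ∀ {x} → parF x ≡ false → halve x ≡ inj₁ (half x)
  halve-even {x} = cong (λ b → if b then inj₂ (half x) else inj₁ (half x))

  halve-odd : ∀ {x} → parF x ≡ true → halve x ≡ inj₂ (half x)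
  halve-odd {x} = cong (λ b → if b then inj₂ (half x) else inj₁ (half x))

  half-evenₙ : ∀ p → half (evenₙ p) ≡ p
  half-evenₙ p = toℕ-injective (begin
    toℕ (half (evenₙ p))        ≡⟨ toℕ-half (evenₙ p) ⟩
    ℕ.⌊ toℕ (evenₙ p) /2⌋       ≡⟨ cong ℕ.⌊_/2⌋ (toℕ-evenₙ p) ⟩
    ℕ.⌊ 2 ℕ.* toℕ p /2⌋         ≡⟨ ⌊2*p/2⌋≡p (toℕ p) ⟩
    toℕ p                       ∎)

  half-oddₙ : ∀ p → half (oddₙ p) ≡ p
  half-oddₙ p = toℕ-injective (begin
    toℕ (half (oddₙ p))         ≡⟨ toℕ-half (oddₙ p) ⟩
    ℕ.⌊ toℕ (oddₙ p) /2⌋        ≡⟨ cong ℕ.⌊_/2⌋ (toℕ-oddₙ p) ⟩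
    ℕ.⌊ suc (2 ℕ.* toℕ p) /2⌋   ≡⟨ ⌊1+2*p/2⌋≡p (toℕ p) ⟩
    toℕ p                       ∎)

  halve-unhalve : ∀ y → halve (unhalve y) ≡ y
  halve-unhalve (inj₁ p) = trans (halve-even (parF-evenₙ p)) (cong inj₁ (half-evenₙ p))
  halve-unhalve (inj₂ p) = trans (halve-odd (parF-oddₙ p)) (cong inj₂ (half-oddₙ p))

  halve↔ : Fin n ↔ (Fin m ⊎ Fin m)
  halve↔ = mk↔ₛ′ halve unhalve halve-unhalve unhalve-halve

  ∑-byParity : ∀ (f : Fun) → sum f ≡ ∑[ p < m ] f (evenₙ p) + ∑[ p < m ] f (oddₙ p)
  ∑-byParity f = begin
    sum f
      ≡⟨ ∑-reindex f (unhalve ∘ F.splitAt m) (F.join m m ∘ halve)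
           (λ x → trans (cong unhalve (FinP.splitAt-join m m (halve x))) (unhalve-halve x))
           (λ i → trans (cong (F.join m m) (halve-unhalve (F.splitAt m i))) (FinP.join-splitAt m m i)) ⟩
    ∑[ i < m ℕ.+ m ] f (unhalve (F.splitAt m i))
      ≡⟨ ∑-splitAt m m _ ⟩
    ∑[ p < m ] f (unhalve (F.splitAt m (p F.↑ˡ m))) + ∑[ p < m ] f (unhalve (F.splitAt m (m F.↑ʳ p)))
      ≡⟨ cong₂ _+_ (∑-cong (λ p → cong (f ∘ unhalve) (FinP.splitAt-↑ˡ m p m)))
                   (∑-cong (λ p → cong (f ∘ unhalve) (FinP.splitAt-↑ʳ m m p))) ⟩
    ∑[ p < m ] f (evenₙ p) + ∑[ p < m ] f (oddₙ p)  ∎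

  ∑-oddₙ : ∀ (f : Fun) → (∀ q → f (evenₙ q) ≡ 0ℤ) → sum f ≡ ∑[ q < m ] f (oddₙ q)
  ∑-oddₙ f f-even≡0 = begin
    sum f                                          ≡⟨ ∑-byParity f ⟩
    ∑[ q < m ] f (evenₙ q) + ∑[ q < m ] f (oddₙ q)
      ≡⟨ cong (_+ ∑[ q < m ] f (oddₙ q)) (trans (∑-cong f-even≡0) (∑-zero m)) ⟩
    0ℤ + ∑[ q < m ] f (oddₙ q)                     ≡⟨ +-identityˡ _ ⟩
    ∑[ q < m ] f (oddₙ q)                          ∎

  ∑-evenₙ : ∀ (f : Fun) → (∀ q → f (oddₙ q) ≡ 0ℤ) → sum f ≡ ∑[ q < m ] f (evenₙ q)
  ∑-evenₙ f f-odd≡0 = begin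
    sum f                                          ≡⟨ ∑-byParity f ⟩
    ∑[ q < m ] f (evenₙ q) + ∑[ q < m ] f (oddₙ q)
      ≡⟨ cong (_+_ (∑[ q < m ] f (evenₙ q))) (trans (∑-cong f-odd≡0) (∑-zero m)) ⟩
    ∑[ q < m ] f (evenₙ q) + 0ℤ                    ≡⟨ +-identityʳ _ ⟩
    ∑[ q < m ] f (evenₙ q)                         ∎

  oddₙ-half : ∀ x → parF x ≡ true → oddₙ (half x) ≡ x
  oddₙ-half x px = trans (cong unhalve (sym (halve-odd {x} px))) (unhalve-halve x)

  0ₘ : Fin m
  0ₘ = fromℕ< (ℕ.>-nonZero⁻¹ m)

  evenₙ-0ₘ : evenₙ 0ₘ ≡ 0ₙ
  evenₙ-0ₘ = toℕ-injective (begin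
    toℕ (evenₙ 0ₘ)   ≡⟨ toℕ-evenₙ 0ₘ ⟩
    2 ℕ.* toℕ 0ₘ     ≡⟨ cong (2 ℕ.*_) (toℕ-fromℕ< (ℕ.>-nonZero⁻¹ m)) ⟩
    0                ≡⟨ sym toℕ-0ₙ ⟩
    toℕ 0ₙ           ∎)

  even⊟odd-onto : ∀ y → parF y ≡ true → Σ (Fin m) λ p → Σ (Fin m) λ B → evenₙ p ⊟ oddₙ B ≡ y
  even⊟odd-onto y py = 0ₘ , half (negF y) , (begin
    evenₙ 0ₘ ⊟ oddₙ (half (negF y))      ≡⟨ cong₂ _⊟_ evenₙ-0ₘ (oddₙ-half (negF y) (trans (parF-negF y) py)) ⟩
    0ₙ ⊟ negF y                          ≡⟨ addF-identityˡ (negF (negF y)) ⟩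
    negF (negF y)                        ≡⟨ ⁻¹-involutive y ⟩
    y                                    ∎)

  ∑-χ : ∀ c → sum (χ c) ≡ + m
  ∑-χ c = begin
    sum (χ c)                                        ≡⟨ ∑-byParity (χ c) ⟩
    ∑[ p < m ] χ c (evenₙ p) + ∑[ p < m ] χ c (oddₙ p)
      ≡⟨ cong₂ _+_ (∑-cong (λ p → cong (λ b → ⟦ not (b xor c) ⟧) (parF-evenₙ p)))
                   (∑-cong (λ p → cong (λ b → ⟦ not (b xor c) ⟧) (parF-oddₙ p))) ⟩
    ∑[ p < m ] ⟦ not c ⟧ + ∑[ p < m ] ⟦ not (not c) ⟧ ≡⟨ cong₂ _+_ (∑-const m _) (∑-const m _) ⟩
    + m * ⟦ not c ⟧ + + m * ⟦ not (not c) ⟧          ≡⟨ complementary c ⟩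
    + m                                               ∎
    where
    complementary : ∀ c → + m * ⟦ not c ⟧ + + m * ⟦ not (not c) ⟧ ≡ + m
    complementary true  = trans (cong (_+ + m * 1ℤ) (*-zeroʳ (+ m))) (trans (+-identityˡ _) (*-identityʳ (+ m)))
    complementary false = trans (cong (_+_ (+ m * 1ℤ)) (*-zeroʳ (+ m))) (trans (+-identityʳ _) (*-identityʳ (+ m)))

module FlagCount {v : ℕ} (I : Fin v → Fin v → Bool) where

  open import Data.Integer using (_+_; _*_; _-_)
  open FinSums

  paths₃ : Fin v → Fin v → ℤ
  paths₃ p B = ∑[ p′ < v ] ∑[ B′ < v ] (⟦ I p′ B′ ⟧ * ⟦ I p′ B ⟧ * ⟦ I p B′ ⟧)

  -- Inclusion–exclusion over the two excluded lines p′ = p and B′ = B.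
  flagCount≡ : ∀ k → (∀ B → ∑[ p < v ] ⟦ I p B ⟧ ≡ k) → (∀ p → ∑[ B < v ] ⟦ I p B ⟧ ≡ k) →
               ∀ p B → + flagCount I p B ≡ paths₃ p B - ⟦ I p B ⟧ * k - ⟦ I p B ⟧ * k + ⟦ I p B ⟧
  flagCount≡ k block-size point-degree p B = begin
    + flagCount I p B
      ≡⟨ sumL≡∑ v _ ⟩
    ∑[ p′ < v ] (+ count (allFin v) (λ B′ → I p′ B′ ∧ not (eqF p′ p) ∧ not (eqF B′ B) ∧ I p′ B ∧ I p B′))
      ≡⟨ ∑-cong (λ p′ → trans (count≡∑ v _) (∑-cong (λ B′ → flag p′ B′))) ⟩
    ∑[ p′ < v ] ∑[ B′ < v ] (⟦ not (eqF p′ p) ⟧ * (⟦ not (eqF B′ B) ⟧ * X p′ B′))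
      ≡⟨ ∑-cong (λ p′ → trans (∑-*ˡ ⟦ not (eqF p′ p) ⟧ (λ B′ → ⟦ not (eqF B′ B) ⟧ * X p′ B′))
                              (cong (⟦ not (eqF p′ p) ⟧ *_) (∑-except B (X p′)))) ⟩
    ∑[ p′ < v ] (⟦ not (eqF p′ p) ⟧ * (sum (X p′) - X p′ B))
      ≡⟨ ∑-except p (λ p′ → sum (X p′) - X p′ B) ⟩
    ∑[ p′ < v ] (sum (X p′) - X p′ B) - (sum (X p) - X p B)
      ≡⟨ cong (_- (sum (X p) - X p B)) (∑-distrib-- (λ p′ → sum (X p′)) (λ p′ → X p′ B)) ⟩
    paths₃ p B - ∑[ p′ < v ] X p′ B - (sum (X p) - X p B)
      ≡⟨ cong₂ (λ u w → paths₃ p B - u - (w - X p B)) through-B through-p ⟩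
    paths₃ p B - ⟦ I p B ⟧ * k - (⟦ I p B ⟧ * k - X p B)
      ≡⟨ cong (λ t → paths₃ p B - ⟦ I p B ⟧ * k - (⟦ I p B ⟧ * k - t))
              (trans (cong (_* ⟦ I p B ⟧) (⟦⟧-idem (I p B))) (⟦⟧-idem (I p B))) ⟩
    paths₃ p B - ⟦ I p B ⟧ * k - (⟦ I p B ⟧ * k - ⟦ I p B ⟧)
      ≡⟨ regroup (paths₃ p B) (⟦ I p B ⟧ * k) ⟦ I p B ⟧ ⟩
    paths₃ p B - ⟦ I p B ⟧ * k - ⟦ I p B ⟧ * k + ⟦ I p B ⟧ ∎
    where
    X : Fin v → Fin v → ℤ
    X p′ B′ = ⟦ I p′ B′ ⟧ * ⟦ I p′ B ⟧ * ⟦ I p B′ ⟧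

    flag : ∀ p′ B′ → ⟦ I p′ B′ ∧ not (eqF p′ p) ∧ not (eqF B′ B) ∧ I p′ B ∧ I p B′ ⟧
                     ≡ ⟦ not (eqF p′ p) ⟧ * (⟦ not (eqF B′ B) ⟧ * X p′ B′)
    flag p′ B′ = begin
      ⟦ I p′ B′ ∧ not (eqF p′ p) ∧ not (eqF B′ B) ∧ I p′ B ∧ I p B′ ⟧
        ≡⟨ ⟦∧⟧ (I p′ B′) _ ⟩
      ⟦ I p′ B′ ⟧ * ⟦ not (eqF p′ p) ∧ not (eqF B′ B) ∧ I p′ B ∧ I p B′ ⟧
        ≡⟨ cong (⟦ I p′ B′ ⟧ *_) (trans (⟦∧⟧ (not (eqF p′ p)) _) (cong (⟦ not (eqF p′ p) ⟧ *_)
             (trans (⟦∧⟧ (not (eqF B′ B)) _) (cong (⟦ not (eqF B′ B) ⟧ *_) (⟦∧⟧ (I p′ B) (I p B′)))))) ⟩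
      ⟦ I p′ B′ ⟧ * (⟦ not (eqF p′ p) ⟧ * (⟦ not (eqF B′ B) ⟧ * (⟦ I p′ B ⟧ * ⟦ I p B′ ⟧)))
        ≡⟨ rearrange ⟦ I p′ B′ ⟧ ⟦ not (eqF p′ p) ⟧ ⟦ not (eqF B′ B) ⟧ ⟦ I p′ B ⟧ ⟦ I p B′ ⟧ ⟩
      ⟦ not (eqF p′ p) ⟧ * (⟦ not (eqF B′ B) ⟧ * X p′ B′) ∎
      where
      rearrange : ∀ x e₁ e₂ y z → x * (e₁ * (e₂ * (y * z))) ≡ e₁ * (e₂ * (x * y * z))
      rearrange = solve-∀

    through-B : ∑[ p′ < v ] X p′ B ≡ ⟦ I p B ⟧ * k
    through-B = begin
      ∑[ p′ < v ] (⟦ I p′ B ⟧ * ⟦ I p′ B ⟧ * ⟦ I p B ⟧)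
        ≡⟨ ∑-cong (λ p′ → cong (_* ⟦ I p B ⟧) (⟦⟧-idem (I p′ B))) ⟩
      ∑[ p′ < v ] (⟦ I p′ B ⟧ * ⟦ I p B ⟧)                ≡⟨ ∑-*ʳ ⟦ I p B ⟧ (λ p′ → ⟦ I p′ B ⟧) ⟩
      ∑[ p′ < v ] ⟦ I p′ B ⟧ * ⟦ I p B ⟧                  ≡⟨ cong (_* ⟦ I p B ⟧) (block-size B) ⟩
      k * ⟦ I p B ⟧                                        ≡⟨ *-comm k _ ⟩
      ⟦ I p B ⟧ * k                                        ∎

    through-p : sum (X p) ≡ ⟦ I p B ⟧ * k
    through-p = begin
      ∑[ B′ < v ] (⟦ I p B′ ⟧ * ⟦ I p B ⟧ * ⟦ I p B′ ⟧)   ≡⟨ ∑-cong (λ B′ → swap ⟦ I p B′ ⟧ ⟦ I p B ⟧) ⟩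
      ∑[ B′ < v ] (⟦ I p B ⟧ * (⟦ I p B′ ⟧ * ⟦ I p B′ ⟧))
        ≡⟨ ∑-cong (λ B′ → cong (⟦ I p B ⟧ *_) (⟦⟧-idem (I p B′))) ⟩
      ∑[ B′ < v ] (⟦ I p B ⟧ * ⟦ I p B′ ⟧)                ≡⟨ ∑-*ˡ ⟦ I p B ⟧ (λ B′ → ⟦ I p B′ ⟧) ⟩
      ⟦ I p B ⟧ * ∑[ B′ < v ] ⟦ I p B′ ⟧                  ≡⟨ cong (⟦ I p B ⟧ *_) (point-degree p) ⟩
      ⟦ I p B ⟧ * k                                        ∎
      where
      swap : ∀ x y → x * y * x ≡ y * (x * x)
      swap = solve-∀

    regroup : ∀ t u w → t - u - (u - w) ≡ t - u - u + w
    regroup = solve-∀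

module IntegerFacts where

  open import Data.Integer using (_+_; _*_; _-_)

  z*z≡z⇒z≡0⊎z≡1 : ∀ z → z * z ≡ z → z ≡ 0ℤ ⊎ z ≡ 1ℤ
  z*z≡z⇒z≡0⊎z≡1 z z²≡z
    with i*j≡0⇒i≡0∨j≡0 z {z - 1ℤ} (trans (factor z) (trans (cong (_- z) z²≡z) (+-inverseʳ z)))
    where
    factor : ∀ z → z * (z - 1ℤ) ≡ z * z - z
    factor = solve-∀
  ... | inj₁ z≡0   = inj₁ z≡0
  ... | inj₂ z-1≡0 = inj₂ (trans (sym (cancel z)) (cong (_+ 1ℤ) z-1≡0))
    where
    cancel : ∀ z → z - 1ℤ + 1ℤ ≡ z
    cancel = solve-∀

  -- Either degenerate case would make K - μ idempotent.
  x≢0×x≢M : ∀ x y M μ K → (x - y) * (x - y) ≡ K - μ → + 2 * (x * y) ≡ μ * M → x + y ≡ K →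
            ¬ M ≡ 0ℤ → ¬ K - μ ≡ 0ℤ → ¬ K - μ ≡ 1ℤ → ¬ x ≡ 0ℤ × ¬ x ≡ M
  x≢0×x≢M x y M μ K [x-y]²≡ 2xy≡ x+y≡K M≢0 ≢0 ≢1 = x≢0 , x≢M
    where
    not-idempotent : ∀ d e → (K - μ ≡ d + e) → d * d ≡ K - μ → e ≡ 0ℤ → ⊥
    not-idempotent d e K-μ≡ d²≡ e≡0 with z*z≡z⇒z≡0⊎z≡1 (K - μ) (begin
      (K - μ) * (K - μ)          ≡⟨ cong₂ _*_ K-μ≡ K-μ≡ ⟩
      (d + e) * (d + e)          ≡⟨ cong (λ t → (d + t) * (d + t)) e≡0 ⟩
      (d + 0ℤ) * (d + 0ℤ)        ≡⟨ cong (λ t → t * t) (+-identityʳ d) ⟩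
      d * d                      ≡⟨ d²≡ ⟩
      K - μ                      ∎)
    ... | inj₁ ≡0 = ≢0 ≡0
    ... | inj₂ ≡1 = ≢1 ≡1
    x≢0 : ¬ x ≡ 0ℤ
    x≢0 x≡0 with i*j≡0⇒i≡0∨j≡0 μ {M} (trans (sym 2xy≡) (cong (λ t → + 2 * (t * y)) x≡0))
    ... | inj₂ M≡0 = M≢0 M≡0
    ... | inj₁ μ≡0 = not-idempotent (y - x) (+ 2 * x - μ)
      (trans (cong (_- μ) (sym x+y≡K)) (regroup x y μ)) (trans (neg-sq x y) [x-y]²≡)
      (cong₂ (λ u v → + 2 * u - v) x≡0 μ≡0)
      where
      regroup : ∀ x y μ → x + y - μ ≡ (y - x) + (+ 2 * x - μ)
      regroup = solve-∀
      neg-sq : ∀ x y → (y - x) * (y - x) ≡ (x - y) * (x - y)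
      neg-sq = solve-∀
    x≢M : ¬ x ≡ M
    x≢M x≡M with i*j≡0⇒i≡0∨j≡0 (+ 2 * y - μ) {M} (begin
      (+ 2 * y - μ) * M          ≡⟨ expand y μ M ⟩
      + 2 * (M * y) - μ * M      ≡⟨ cong (λ t → + 2 * (t * y) - μ * M) (sym x≡M) ⟩
      + 2 * (x * y) - μ * M      ≡⟨ cong (_- μ * M) 2xy≡ ⟩
      μ * M - μ * M              ≡⟨ +-inverseʳ (μ * M) ⟩
      0ℤ                         ∎)
      where
      expand : ∀ y μ M → (+ 2 * y - μ) * M ≡ + 2 * (M * y) - μ * M
      expand = solve-∀
    ... | inj₂ M≡0     = M≢0 M≡0
    ... | inj₁ 2y-μ≡0 = not-idempotent (x - y) (+ 2 * y - μ)
      (trans (cong (_- μ) (sym x+y≡K)) (regroup x y μ)) [x-y]²≡ 2y-μ≡0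
      where
      regroup : ∀ x y μ → x + y - μ ≡ (x - y) + (+ 2 * y - μ)
      regroup = solve-∀

module Core (m : ℕ) .{{_ : NonZero m}} where

  open import Data.Integer using (_+_; _*_; _-_)
  open FinSums
  open IntegerFacts

  open Dihedral m
  open CyclicGroup m
  open Convolution m
  open ParityClasses m

  𝟙 : (Fin n → Bool) → Fun
  𝟙 P y = ⟦ P y ⟧

  -- For A = {x | r^x ∈ S} and B = {x | r^x s ∈ S}, the identity S² = (k - μ)e + μH in the
  -- group ring of D splits into the rotation and reflection parts below, where
  -- H = {r^x | x even} ∪ {r^x s | parity of x = ps}.
  record SquareIdentity (A B : Fin n → Bool) (ps : Bool) (k μ : ℕ) : Set where
    field
      A-odd           : ∀ x → A x ≡ true → parF x ≡ true
      B-parity        : ∀ x → B x ≡ true → parF x ≡ not ps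
      A-symmetric     : ∀ x → A (negF x) ≡ A x
      rotation-part   : ∀ t → (𝟙 A ⋆ 𝟙 A) t + (𝟙 B ⋆ 𝟙 (B ∘ negF)) t ≡ (+ k - + μ) * δ t + + μ * χ false t
      reflection-part : ∀ t → + 2 * (𝟙 A ⋆ 𝟙 B) t ≡ + μ * χ ps t
      degree          : sum (𝟙 A) + sum (𝟙 B) ≡ + k

  module Consequences {A B ps k μ} (sq : SquareIdentity A B ps k μ) (μ<k∸1 : μ ℕ.< k ℕ.∸ 1) where

    open SquareIdentity sq

    a b b̃ : Fun
    a = 𝟙 A
    b = 𝟙 B
    b̃ = 𝟙 (B ∘ negF)

    k₁ : ℕ
    k₁ = count (allFin n) A

    k₂ s² : ℤ
    k₂ = + k - + k₁
    s² = + k - + μ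

    ∑a : sum a ≡ + k₁
    ∑a = sym (count≡∑ n A)

    ∑b : sum b ≡ k₂
    ∑b = begin
      sum b                      ≡⟨ add-sub (sum a) (sum b) ⟩
      sum a + sum b - sum a      ≡⟨ cong₂ _-_ degree ∑a ⟩
      + k - + k₁                 ∎
      where
      add-sub : ∀ x y → y ≡ x + y - x
      add-sub = solve-∀

    ∑b̃ : sum b̃ ≡ k₂
    ∑b̃ = trans (sym (∑-negate b)) ∑b

    μ≤k : μ ℕ.≤ k
    μ≤k = ℕP.≤-trans (ℕP.<⇒≤ μ<k∸1) (ℕP.m∸n≤m k 1)

    s²≡k∸μ : s² ≡ + (k ℕ.∸ μ)
    s²≡k∸μ = trans (m-n≡m⊖n k μ) (⊖-≥ μ≤k)

    2≤k∸μ : 2 ℕ.≤ k ℕ.∸ μ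
    2≤k∸μ = go k μ μ<k∸1
      where
      go : ∀ k μ → μ ℕ.< k ℕ.∸ 1 → 2 ℕ.≤ k ℕ.∸ μ
      go (suc (suc k)) zero    _   = s≤s (s≤s z≤n)
      go (suc (suc k)) (suc μ) μ<k = go (suc k) μ (ℕP.∸-monoˡ-≤ 1 μ<k)

    s²≢0 : ¬ s² ≡ 0ℤ
    s²≢0 s²≡0 with subst (2 ℕ.≤_) (ℤP.+-injective (trans (sym s²≡k∸μ) s²≡0)) 2≤k∸μ
    ... | ()

    s²≢1 : ¬ s² ≡ 1ℤ
    s²≢1 s²≡1 with subst (2 ℕ.≤_) (ℤP.+-injective (trans (sym s²≡k∸μ) s²≡1)) 2≤k∸μ
    ... | s≤s ()

    supp-a : SupportedIn true a
    supp-a u pu with A u in Au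
    ... | false = refl
    ... | true  with trans (sym (A-odd u Au)) pu
    ... | ()

    supp-b : SupportedIn (not ps) b
    supp-b u pu with B u in Bu
    ... | false = refl
    ... | true  = ⊥-elim (BoolP.not-¬ refl (trans (sym (B-parity u Bu)) pu))

    supp-b̃ : SupportedIn (not ps) b̃
    supp-b̃ u pu = supp-b (negF u) (trans (parF-negF u) pu)

    k₁²+k₂²≡ : + k₁ * + k₁ + k₂ * k₂ ≡ s² + + μ * + m
    k₁²+k₂²≡ = begin
      + k₁ * + k₁ + k₂ * k₂
        ≡⟨ cong₂ _+_ (cong₂ _*_ (sym ∑a) (sym ∑a)) (cong₂ _*_ (sym ∑b) (sym ∑b̃)) ⟩
      sum a * sum a + sum b * sum b̃                          ≡⟨ sym (cong₂ _+_ (∑-⋆ a a) (∑-⋆ b b̃)) ⟩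
      sum (a ⋆ a) + sum (b ⋆ b̃)                              ≡⟨ sym (∑-distrib-+ (a ⋆ a) (b ⋆ b̃)) ⟩
      ∑[ t < n ] ((a ⋆ a) t + (b ⋆ b̃) t)                     ≡⟨ ∑-cong rotation-part ⟩
      ∑[ t < n ] (s² * δ t + + μ * χ false t)                 ≡⟨ ∑-distrib-+ (λ t → s² * δ t) (λ t → + μ * χ false t) ⟩
      ∑[ t < n ] (s² * δ t) + ∑[ t < n ] (+ μ * χ false t)    ≡⟨ cong₂ _+_ (∑-*ˡ s² δ) (∑-*ˡ (+ μ) (χ false)) ⟩
      s² * sum δ + + μ * sum (χ false)                        ≡⟨ cong₂ (λ u v → s² * u + + μ * v) ∑-δₙ (∑-χ false) ⟩
      s² * 1ℤ + + μ * + m                                     ≡⟨ cong (_+ + μ * + m) (*-identityʳ s²) ⟩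
      s² + + μ * + m                                          ∎

    2k₁k₂≡ : + 2 * (+ k₁ * k₂) ≡ + μ * + m
    2k₁k₂≡ = begin
      + 2 * (+ k₁ * k₂)             ≡⟨ cong (λ t → + 2 * t) (trans (cong₂ _*_ (sym ∑a) (sym ∑b)) (sym (∑-⋆ a b))) ⟩
      + 2 * sum (a ⋆ b)             ≡⟨ sym (∑-*ˡ (+ 2) (a ⋆ b)) ⟩
      ∑[ t < n ] (+ 2 * (a ⋆ b) t)  ≡⟨ ∑-cong reflection-part ⟩
      ∑[ t < n ] (+ μ * χ ps t)     ≡⟨ ∑-*ˡ (+ μ) (χ ps) ⟩
      + μ * sum (χ ps)              ≡⟨ cong (+ μ *_) (∑-χ ps) ⟩
      + μ * + m                     ∎

    [k₁-k₂]²≡s² : (+ k₁ - k₂) * (+ k₁ - k₂) ≡ s²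
    [k₁-k₂]²≡s² = begin
      (+ k₁ - k₂) * (+ k₁ - k₂)                       ≡⟨ square-diff (+ k₁) k₂ ⟩
      (+ k₁ * + k₁ + k₂ * k₂) - + 2 * (+ k₁ * k₂)     ≡⟨ cong₂ _-_ k₁²+k₂²≡ 2k₁k₂≡ ⟩
      s² + + μ * + m - + μ * + m                      ≡⟨ add-sub s² (+ μ * + m) ⟩
      s²                                              ∎
      where
      square-diff : ∀ x y → (x - y) * (x - y) ≡ (x * x + y * y) - + 2 * (x * y)
      square-diff = solve-∀
      add-sub : ∀ z w → z + w - w ≡ z
      add-sub = solve-∀

    m≢0 : ¬ + m ≡ 0ℤ
    m≢0 m≡0 = ℕ.≢-nonZero⁻¹ m (ℤP.+-injective m≡0)

    k₁+k₂≡k : + k₁ + k₂ ≡ + k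
    k₁+k₂≡k = trans (cong (_+ k₂) (sym ∑a)) (trans (cong (_+_ (sum a)) (sym ∑b)) degree)

    k₁≢0×k₁≢m : ¬ + k₁ ≡ 0ℤ × ¬ + k₁ ≡ + m
    k₁≢0×k₁≢m = x≢0×x≢M (+ k₁) k₂ (+ m) (+ μ) (+ k) [k₁-k₂]²≡s² 2k₁k₂≡ k₁+k₂≡k m≢0 s²≢0 s²≢1

    k₂≢0×k₂≢m : ¬ k₂ ≡ 0ℤ × ¬ k₂ ≡ + m
    k₂≢0×k₂≢m = x≢0×x≢M k₂ (+ k₁) (+ m) (+ μ) (+ k)
      (trans (swap-sq k₂ (+ k₁)) [k₁-k₂]²≡s²) (trans (cong (+ 2 *_) (*-comm k₂ (+ k₁))) 2k₁k₂≡)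
      (trans (+-comm k₂ (+ k₁)) k₁+k₂≡k) m≢0 s²≢0 s²≢1
      where
      swap-sq : ∀ x y → (x - y) * (x - y) ≡ (y - x) * (y - x)
      swap-sq = solve-∀

    -- opaque: these witnesses come from a search, and unfolding them makes type checking explode
    opaque
      A-nonempty : Σ (Fin n) λ x → A x ≡ true
      A-nonempty = ∑⟦⟧≢0⇒∃ A (λ ∑a≡0 → proj₁ k₁≢0×k₁≢m (trans (sym ∑a) ∑a≡0))

      B-nonempty : Σ (Fin n) λ x → B x ≡ true
      B-nonempty = ∑⟦⟧≢0⇒∃ B (λ ∑b≡0 → proj₁ k₂≢0×k₂≢m (trans (sym ∑b) ∑b≡0))

      odd-non-neighbour : Σ (Fin n) λ x → A x ≡ false × parF x ≡ true
      odd-non-neighbour =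
        let x , ax<χx = ∑<∑⇒∃< a (χ true) (subst₂ ℤ._<_ (sym ∑a) (sym (∑-χ true)) k₁<m)
        in  x , <χ (A x) (parF x) ax<χx
        where
        k₁≤m : + k₁ ℤ.≤ + m
        k₁≤m = subst₂ ℤ._≤_ ∑a (∑-χ true) (∑-mono-≤ a≤χ)
          where
          a≤χ : ∀ x → a x ℤ.≤ χ true x
          a≤χ x with A x in Ax
          ... | false = 0≤⟦⟧ _
          ... | true  = ℤP.≤-reflexive (cong (λ p → ⟦ not (p xor true) ⟧) (sym (A-odd x Ax)))
        k₁<m : + k₁ ℤ.< + m
        k₁<m = ≤∧≢⇒< k₁≤m (proj₂ k₁≢0×k₁≢m)
        <χ : ∀ P q → ⟦ P ⟧ ℤ.< ⟦ not (q xor true) ⟧ → P ≡ false × q ≡ true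
        <χ false true  _                = refl , refl
        <χ true  true  (ℤ.+<+ (s≤s ()))
        <χ true  false (ℤ.+<+ ())
        <χ false false (ℤ.+<+ ())

    a³ : Fun
    a³ = a ⋆ (a ⋆ a)

    a³+a⋆b⋆b̃≡ : ∀ x → a³ x + (a ⋆ (b ⋆ b̃)) x ≡ s² * a x + + μ * (+ k₁ * χ true x)
    a³+a⋆b⋆b̃≡ x = begin
      a³ x + (a ⋆ (b ⋆ b̃)) x                          ≡⟨ sym (⋆-distribˡ a (a ⋆ a) (b ⋆ b̃) x) ⟩
      (a ⋆ (λ y → (a ⋆ a) y + (b ⋆ b̃) y)) x           ≡⟨ ⋆-congʳ a rotation-part x ⟩
      (a ⋆ (λ y → s² * δ y + + μ * χ false y)) x      ≡⟨ ⋆-linearʳ a δ (χ false) s² (+ μ) x ⟩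
      s² * (a ⋆ δ) x + + μ * (a ⋆ χ false) x
        ≡⟨ cong₂ (λ u v → s² * u + + μ * v) (⋆-identityʳ a x) (⋆-χ a false supp-a x) ⟩
      s² * a x + + μ * (sum a * χ true x)             ≡⟨ cong (λ t → s² * a x + + μ * (t * χ true x)) ∑a ⟩
      s² * a x + + μ * (+ k₁ * χ true x)              ∎

    2a⋆b⋆b̃≡ : ∀ x → + 2 * (a ⋆ (b ⋆ b̃)) x ≡ + μ * (k₂ * χ true x)
    2a⋆b⋆b̃≡ x = begin
      + 2 * (a ⋆ (b ⋆ b̃)) x                 ≡⟨ cong (+ 2 *_) (sym (⋆-assoc a b b̃ x)) ⟩
      + 2 * ((a ⋆ b) ⋆ b̃) x                 ≡⟨ sym (⋆-scaleˡ (+ 2) (a ⋆ b) b̃ x) ⟩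
      ((λ y → + 2 * (a ⋆ b) y) ⋆ b̃) x       ≡⟨ ⋆-cong reflection-part (λ _ → refl) x ⟩
      ((λ y → + μ * χ ps y) ⋆ b̃) x          ≡⟨ ⋆-scaleˡ (+ μ) (χ ps) b̃ x ⟩
      + μ * (χ ps ⋆ b̃) x                    ≡⟨ cong (+ μ *_) (⋆-comm (χ ps) b̃ x) ⟩
      + μ * (b̃ ⋆ χ ps) x                    ≡⟨ cong (+ μ *_) (⋆-χ b̃ ps supp-b̃ x) ⟩
      + μ * (sum b̃ * χ (not ps xor ps) x)   ≡⟨ cong₂ (λ u c → + μ * (u * χ c x)) ∑b̃ (BoolP.xor-inverseˡ ps) ⟩
      + μ * (k₂ * χ true x)                 ∎

    2a³≡ : ∀ x → + 2 * a³ x ≡ + 2 * s² * a x + + μ * (+ 2 * + k₁ - k₂) * χ true x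
    2a³≡ x = begin
      + 2 * a³ x
        ≡⟨ isolate (a³ x) ((a ⋆ (b ⋆ b̃)) x) _ (a³+a⋆b⋆b̃≡ x) ⟩
      + 2 * (s² * a x + + μ * (+ k₁ * χ true x)) - + 2 * (a ⋆ (b ⋆ b̃)) x
        ≡⟨ cong (_-_ (+ 2 * (s² * a x + + μ * (+ k₁ * χ true x)))) (2a⋆b⋆b̃≡ x) ⟩
      + 2 * (s² * a x + + μ * (+ k₁ * χ true x)) - + μ * (k₂ * χ true x)
        ≡⟨ collect s² (a x) (+ μ) (+ k₁) k₂ (χ true x) ⟩
      + 2 * s² * a x + + μ * (+ 2 * + k₁ - k₂) * χ true x ∎
      where
      isolate : ∀ p q r → p + q ≡ r → + 2 * p ≡ + 2 * r - + 2 * q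
      isolate p q r p+q≡r = trans (twice p q) (cong (λ t → + 2 * t - + 2 * q) p+q≡r)
        where
        twice : ∀ p q → + 2 * p ≡ + 2 * (p + q) - + 2 * q
        twice = solve-∀
      collect : ∀ s a μ k₁ k₂ χ →
                + 2 * (s * a + μ * (k₁ * χ)) - μ * (k₂ * χ) ≡ + 2 * s * a + μ * (+ 2 * k₁ - k₂) * χ
      collect = solve-∀

    x₀ : Fin n
    x₀ = proj₁ odd-non-neighbour

    α : ℤ
    α = a³ x₀

    2α≡ : + 2 * α ≡ + μ * (+ 2 * + k₁ - k₂)
    2α≡ = begin
      + 2 * a³ x₀                                                ≡⟨ 2a³≡ x₀ ⟩
      + 2 * s² * a x₀ + + μ * (+ 2 * + k₁ - k₂) * χ true x₀
        ≡⟨ cong₂ (λ u v → + 2 * s² * ⟦ u ⟧ + + μ * (+ 2 * + k₁ - k₂) * ⟦ not (v xor true) ⟧)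
                 (proj₁ (proj₂ odd-non-neighbour)) (proj₂ (proj₂ odd-non-neighbour)) ⟩
      + 2 * s² * 0ℤ + + μ * (+ 2 * + k₁ - k₂) * 1ℤ              ≡⟨ simplify (+ 2 * s²) (+ μ * (+ 2 * + k₁ - k₂)) ⟩
      + μ * (+ 2 * + k₁ - k₂)                                    ∎
      where
      simplify : ∀ u v → u * 0ℤ + v * 1ℤ ≡ v
      simplify = solve-∀

    a³≡ : ∀ x → a³ x ≡ s² * a x + α * χ true x
    a³≡ x = *-cancelˡ-≡ (+ 2) (a³ x) (s² * a x + α * χ true x) (begin
      + 2 * a³ x                                            ≡⟨ 2a³≡ x ⟩
      + 2 * s² * a x + + μ * (+ 2 * + k₁ - k₂) * χ true x   ≡⟨ cong (λ t → + 2 * s² * a x + t * χ true x) (sym 2α≡) ⟩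
      + 2 * s² * a x + + 2 * α * χ true x                   ≡⟨ factor s² (a x) α (χ true x) ⟩
      + 2 * (s² * a x + α * χ true x)                       ∎)
      where
      factor : ∀ s a α χ → + 2 * s * a + + 2 * α * χ ≡ + 2 * (s * a + α * χ)
      factor = solve-∀

    A-same-parity : ∀ x y → parF x ≡ parF y → A (x ⊟ y) ≡ false
    A-same-parity x y px≡py with A (x ⊟ y) in A⊟
    ... | false = refl
    ... | true  with trans (sym (A-odd _ A⊟)) (begin
      parF (x ⊟ y)           ≡⟨ parF-⊟ x y ⟩
      parF x xor parF y      ≡⟨ cong (_xor parF y) px≡py ⟩
      parF y xor parF y      ≡⟨ xor-same (parF y) ⟩
      false                  ∎)
    ... | ()

    a-even-even : ∀ p q → a (evenₙ p ⊟ evenₙ q) ≡ 0ℤ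
    a-even-even p q = cong ⟦_⟧ (A-same-parity (evenₙ p) (evenₙ q) (trans (parF-evenₙ p) (sym (parF-evenₙ q))))

    a-odd-odd : ∀ p q → a (oddₙ p ⊟ oddₙ q) ≡ 0ℤ
    a-odd-odd p q = cong ⟦_⟧ (A-same-parity (oddₙ p) (oddₙ q) (trans (parF-oddₙ p) (sym (parF-oddₙ q))))

    -- points are the even rotations, blocks the odd ones
    I : Fin m → Fin m → Bool
    I p B = A (evenₙ p ⊟ oddₙ B)

    I-transpose : ∀ p B → A (oddₙ B ⊟ evenₙ p) ≡ I p B
    I-transpose p B = trans (cong A (sym (⁻¹-anti-homo‿- (evenₙ p) (oddₙ B)))) (A-symmetric _)

    block-size : ∀ B → ∑[ p < m ] ⟦ I p B ⟧ ≡ + k₁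
    block-size B = sym (begin
      + k₁                              ≡⟨ sym ∑a ⟩
      sum a                             ≡⟨ ∑-translate a (negF (oddₙ B)) ⟩
      ∑[ x < n ] a (x ⊟ oddₙ B)         ≡⟨ ∑-evenₙ (λ x → a (x ⊟ oddₙ B)) (λ q → a-odd-odd q B) ⟩
      ∑[ p < m ] ⟦ I p B ⟧              ∎)

    point-degree : ∀ p → ∑[ B < m ] ⟦ I p B ⟧ ≡ + k₁
    point-degree p = sym (begin
      + k₁                              ≡⟨ sym ∑a ⟩
      sum a                             ≡⟨ ∑-reflect a (evenₙ p) ⟩
      ∑[ x < n ] a (evenₙ p ⊟ x)        ≡⟨ ∑-oddₙ (λ x → a (evenₙ p ⊟ x)) (a-even-even p) ⟩
      ∑[ B < m ] ⟦ I p B ⟧              ∎)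

    open FlagCount I using (paths₃; flagCount≡)

    paths₃≡a³ : ∀ p B → paths₃ p B ≡ a³ (evenₙ p ⊟ oddₙ B)
    paths₃≡a³ p B = sym (begin
      a³ (evenₙ p ⊟ oddₙ B)
        ≡⟨ sym (∑-circulant a (a ⋆ a) (evenₙ p) (oddₙ B)) ⟩
      ∑[ l < n ] (a (evenₙ p ⊟ l) * (a ⋆ a) (l ⊟ oddₙ B))
        ≡⟨ ∑-oddₙ (λ l → a (evenₙ p ⊟ l) * (a ⋆ a) (l ⊟ oddₙ B))
                 (λ q → trans (cong (_* (a ⋆ a) (evenₙ q ⊟ oddₙ B)) (a-even-even p q))
                              (*-zeroˡ ((a ⋆ a) (evenₙ q ⊟ oddₙ B)))) ⟩
      ∑[ B′ < m ] (⟦ I p B′ ⟧ * (a ⋆ a) (oddₙ B′ ⊟ oddₙ B))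
        ≡⟨ ∑-cong (λ B′ → cong (⟦ I p B′ ⟧ *_) (a⋆a-odd-odd B′)) ⟩
      ∑[ B′ < m ] (⟦ I p B′ ⟧ * ∑[ p′ < m ] (⟦ I p′ B′ ⟧ * ⟦ I p′ B ⟧))
        ≡⟨ ∑-cong (λ B′ → sym (∑-*ˡ ⟦ I p B′ ⟧ (λ p′ → ⟦ I p′ B′ ⟧ * ⟦ I p′ B ⟧))) ⟩
      ∑[ B′ < m ] ∑[ p′ < m ] (⟦ I p B′ ⟧ * (⟦ I p′ B′ ⟧ * ⟦ I p′ B ⟧))
        ≡⟨ ∑-comm (λ B′ p′ → ⟦ I p B′ ⟧ * (⟦ I p′ B′ ⟧ * ⟦ I p′ B ⟧)) ⟩
      ∑[ p′ < m ] ∑[ B′ < m ] (⟦ I p B′ ⟧ * (⟦ I p′ B′ ⟧ * ⟦ I p′ B ⟧))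
        ≡⟨ ∑-cong (λ p′ → ∑-cong (λ B′ → rotate ⟦ I p B′ ⟧ ⟦ I p′ B′ ⟧ ⟦ I p′ B ⟧)) ⟩
      paths₃ p B ∎)
      where
      rotate : ∀ x y z → x * (y * z) ≡ y * z * x
      rotate = solve-∀
      a⋆a-odd-odd : ∀ B′ → (a ⋆ a) (oddₙ B′ ⊟ oddₙ B) ≡ ∑[ p′ < m ] (⟦ I p′ B′ ⟧ * ⟦ I p′ B ⟧)
      a⋆a-odd-odd B′ = begin
        (a ⋆ a) (oddₙ B′ ⊟ oddₙ B)
          ≡⟨ sym (∑-circulant a a (oddₙ B′) (oddₙ B)) ⟩
        ∑[ l < n ] (a (oddₙ B′ ⊟ l) * a (l ⊟ oddₙ B))
          ≡⟨ ∑-evenₙ (λ l → a (oddₙ B′ ⊟ l) * a (l ⊟ oddₙ B))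
                     (λ q → trans (cong (_* a (oddₙ q ⊟ oddₙ B)) (a-odd-odd B′ q)) (*-zeroˡ (a (oddₙ q ⊟ oddₙ B)))) ⟩
        ∑[ p′ < m ] (a (oddₙ B′ ⊟ evenₙ p′) * ⟦ I p′ B ⟧)
          ≡⟨ ∑-cong (λ p′ → cong (λ t → ⟦ t ⟧ * ⟦ I p′ B ⟧) (I-transpose p′ B′)) ⟩
        ∑[ p′ < m ] (⟦ I p′ B′ ⟧ * ⟦ I p′ B ⟧)                 ∎

    flagsOf : Bool → ℤ
    flagsOf c = s² * ⟦ c ⟧ + α - ⟦ c ⟧ * + k₁ - ⟦ c ⟧ * + k₁ + ⟦ c ⟧

    flagCount≡flagsOf : ∀ p B → + flagCount I p B ≡ flagsOf (I p B)
    flagCount≡flagsOf p B = trans (flagCount≡ (+ k₁) block-size point-degree p B)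
      (cong (λ t → t - ⟦ I p B ⟧ * + k₁ - ⟦ I p B ⟧ * + k₁ + ⟦ I p B ⟧) (begin
        paths₃ p B                                       ≡⟨ paths₃≡a³ p B ⟩
        a³ (evenₙ p ⊟ oddₙ B)                            ≡⟨ a³≡ _ ⟩
        s² * ⟦ I p B ⟧ + α * χ true (evenₙ p ⊟ oddₙ B)   ≡⟨ cong (λ c → s² * ⟦ I p B ⟧ + α * ⟦ not (c xor true) ⟧) odd-diff ⟩
        s² * ⟦ I p B ⟧ + α * 1ℤ                          ≡⟨ cong (_+_ (s² * ⟦ I p B ⟧)) (*-identityʳ α) ⟩
        s² * ⟦ I p B ⟧ + α                               ∎))
      where
      odd-diff : parF (evenₙ p ⊟ oddₙ B) ≡ true
      odd-diff = trans (parF-⊟ (evenₙ p) (oddₙ B)) (cong₂ _xor_ (parF-evenₙ p) (parF-oddₙ B))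

    pair-at : ∀ y → parF y ≡ true → Σ (Fin m) λ p → Σ (Fin m) λ B → I p B ≡ A y
    pair-at y py = let p , B , p⊟B≡y = even⊟odd-onto y py in p , B , cong A p⊟B≡y

    incident-pair : Σ (Fin m) λ p → Σ (Fin m) λ B → I p B ≡ true
    incident-pair = let x , Ax = A-nonempty ; p , B , I≡A = pair-at x (A-odd x Ax) in p , B , trans I≡A Ax

    non-incident-pair : Σ (Fin m) λ p → Σ (Fin m) λ B → I p B ≡ false
    non-incident-pair = let x , ¬Ax , px = odd-non-neighbour ; p , B , I≡A = pair-at x px in p , B , trans I≡A ¬Ax

    flags₀ flags₁ : ℕ
    flags₀ = flagCount I (proj₁ non-incident-pair) (proj₁ (proj₂ non-incident-pair))
    flags₁ = flagCount I (proj₁ incident-pair) (proj₁ (proj₂ incident-pair))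

    flags₀≡ : + flags₀ ≡ flagsOf false
    flags₀≡ = trans (flagCount≡flagsOf (proj₁ non-incident-pair) (proj₁ (proj₂ non-incident-pair)))
                    (cong flagsOf (proj₂ (proj₂ non-incident-pair)))

    flags₁≡ : + flags₁ ≡ flagsOf true
    flags₁≡ = trans (flagCount≡flagsOf (proj₁ incident-pair) (proj₁ (proj₂ incident-pair)))
                    (cong flagsOf (proj₂ (proj₂ incident-pair)))

    flag-count : ∀ p B → flagCount I p B ≡ (if I p B then flags₁ else flags₀)
    flag-count p B = ℤP.+-injective (trans (flagCount≡flagsOf p B) (flagsOf≡ (I p B)))
      where
      flagsOf≡ : ∀ c → flagsOf c ≡ + (if c then flags₁ else flags₀)
      flagsOf≡ true  = sym flags₁≡
      flagsOf≡ false = sym flags₀≡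

    design : IsSymPGD m k₁ flags₀ flags₁ I
    design = record
      { block-size = λ B → ℤP.+-injective (trans (count≡∑ m _) (block-size B))
      ; point-deg  = λ p → ℤP.+-injective (trans (count≡∑ m _) (point-degree p))
      ; flag-count = flag-count
      }

    adj-unhalve : ∀ u w → A (unhalve u ⊟ unhalve w) ≡ incAdj I u w
    adj-unhalve (inj₁ p) (inj₁ q) = A-same-parity (evenₙ p) (evenₙ q) (trans (parF-evenₙ p) (sym (parF-evenₙ q)))
    adj-unhalve (inj₁ p) (inj₂ B) = refl
    adj-unhalve (inj₂ B) (inj₁ p) = I-transpose p B
    adj-unhalve (inj₂ B) (inj₂ C) = A-same-parity (oddₙ B) (oddₙ C) (trans (parF-oddₙ B) (sym (parF-oddₙ C)))

    incidence-graph : IsIncidenceGraphOfSymPGD (λ x y → A (x ⊟ y)) m k₁ flags₀ flags₁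
    incidence-graph = I , design , halve↔ , λ x y → begin
      A (x ⊟ y)                                   ≡⟨ cong₂ (λ u w → A (u ⊟ w)) (sym (unhalve-halve x)) (sym (unhalve-halve y)) ⟩
      A (unhalve (halve x) ⊟ unhalve (halve y))   ≡⟨ adj-unhalve (halve x) (halve y) ⟩
      incAdj I (halve x) (halve y)                ∎

    flags₀≡α : + flags₀ ≡ α
    flags₀≡α = trans flags₀≡ (simplify s² α (+ k₁))
      where
      simplify : ∀ s α k → s * 0ℤ + α - 0ℤ * k - 0ℤ * k + 0ℤ ≡ α
      simplify = solve-∀

    2flags₀≡ : + 2 * + flags₀ ≡ + μ * (+ 2 * + k₁ - k₂)
    2flags₀≡ = trans (cong (+ 2 *_) flags₀≡α) 2α≡

    flags-difference : + 2 * + k₁ - 1ℤ + + flags₁ - + flags₀ ≡ (+ k₁ - k₂) * (+ k₁ - k₂)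
    flags-difference = begin
      + 2 * + k₁ - 1ℤ + + flags₁ - + flags₀        ≡⟨ cong₂ (λ u v → + 2 * + k₁ - 1ℤ + u - v) flags₁≡ flags₀≡ ⟩
      + 2 * + k₁ - 1ℤ + flagsOf true - flagsOf false ≡⟨ simplify s² α (+ k₁) ⟩
      s²                                            ≡⟨ sym [k₁-k₂]²≡s² ⟩
      (+ k₁ - k₂) * (+ k₁ - k₂)                     ∎
      where
      simplify : ∀ s α k →
                 + 2 * k - 1ℤ + (s * 1ℤ + α - 1ℤ * k - 1ℤ * k + 1ℤ) - (s * 0ℤ + α - 0ℤ * k - 0ℤ * k + 0ℤ) ≡ s
      simplify = solve-∀

    s : ℕ
    s = ℤ.∣ + k₁ - k₂ ∣

    s*s≡s² : + s * + s ≡ s²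
    s*s≡s² with +∣i∣≡i⊎+∣i∣≡-i (+ k₁ - k₂)
    ... | inj₁ ∣d∣≡d  = trans (cong₂ _*_ ∣d∣≡d ∣d∣≡d) [k₁-k₂]²≡s²
    ... | inj₂ ∣d∣≡-d = trans (cong₂ _*_ ∣d∣≡-d ∣d∣≡-d) (trans (neg-sq (+ k₁ - k₂)) [k₁-k₂]²≡s²)
      where
      neg-sq : ∀ d → - d * - d ≡ d * d
      neg-sq = solve-∀

    s*s≡k∸μ : s ℕ.* s ≡ k ℕ.∸ μ
    s*s≡k∸μ = ℤP.+-injective (trans (pos-* s s) (trans s*s≡s² s²≡k∸μ))

    M : Mat n
    M = adjMat (λ i j → A (i ⊟ j))

    eigenvalue-from : ∀ λ′ v i₀ → ¬ v i₀ ≡ 0ℤ → (∀ x → (a ⋆ v) x ≡ λ′ * v x) → IsEigenvalue M λ′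
    eigenvalue-from λ′ v i₀ v≢0 av≡ = v , (i₀ , v≢0) , λ i → trans (sumFin≡∑ n _) (av≡ i)

    x₁ : Fin n
    x₁ = proj₁ A-nonempty

    x₁-odd : parF x₁ ≡ true
    x₁-odd = A-odd x₁ (proj₂ A-nonempty)

    k₁-eigenvalue : IsEigenvalue M (+ k₁)
    k₁-eigenvalue = eigenvalue-from (+ k₁) (λ _ → 1ℤ) x₁ (λ ())
                                    (λ x → trans (⋆-const a 1ℤ x) (cong (_* 1ℤ) ∑a))

    -k₁-eigenvalue : IsEigenvalue M (- + k₁)
    -k₁-eigenvalue = eigenvalue-from (- + k₁) alternating x₁ alternating-x₁ λ x → begin
      (a ⋆ alternating) x
        ≡⟨ ⋆-linearʳ a (χ false) (χ true) 1ℤ (- 1ℤ) x ⟩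
      1ℤ * (a ⋆ χ false) x + - 1ℤ * (a ⋆ χ true) x
        ≡⟨ cong₂ (λ u w → 1ℤ * u + - 1ℤ * w) (⋆-χ a false supp-a x) (⋆-χ a true supp-a x) ⟩
      1ℤ * (sum a * χ true x) + - 1ℤ * (sum a * χ false x)
        ≡⟨ cong (λ t → 1ℤ * (t * χ true x) + - 1ℤ * (t * χ false x)) ∑a ⟩
      1ℤ * (+ k₁ * χ true x) + - 1ℤ * (+ k₁ * χ false x)       ≡⟨ factor (+ k₁) (χ true x) (χ false x) ⟩
      - + k₁ * alternating x                                   ∎
      where
      alternating : Fun
      alternating y = 1ℤ * χ false y + - 1ℤ * χ true y
      alternating-x₁ : ¬ alternating x₁ ≡ 0ℤ
      alternating-x₁ = at-odd (parF x₁) x₁-odd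
        where
        at-odd : ∀ c → c ≡ true → ¬ 1ℤ * ⟦ not (c xor false) ⟧ + - 1ℤ * ⟦ not (c xor true) ⟧ ≡ 0ℤ
        at-odd .true refl ()
      factor : ∀ k o e → 1ℤ * (k * o) + - 1ℤ * (k * e) ≡ - k * (1ℤ * e + - 1ℤ * o)
      factor = solve-∀

    k₁³≡ : + k₁ * (+ k₁ * + k₁) ≡ s² * + k₁ + α * + m
    k₁³≡ = begin
      + k₁ * (+ k₁ * + k₁)                      ≡⟨ cong₂ (λ u w → u * (w * w)) (sym ∑a) (sym ∑a) ⟩
      sum a * (sum a * sum a)                   ≡⟨ cong (sum a *_) (sym (∑-⋆ a a)) ⟩
      sum a * sum (a ⋆ a)                       ≡⟨ sym (∑-⋆ a (a ⋆ a)) ⟩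
      sum a³                                    ≡⟨ ∑-cong a³≡ ⟩
      ∑[ x < n ] (s² * a x + α * χ true x)       ≡⟨ ∑-distrib-+ (λ x → s² * a x) (λ x → α * χ true x) ⟩
      ∑[ x < n ] (s² * a x) + ∑[ x < n ] (α * χ true x)
        ≡⟨ cong₂ _+_ (trans (∑-*ˡ s² a) (cong (s² *_) ∑a)) (trans (∑-*ˡ α (χ true)) (cong (α *_) (∑-χ true))) ⟩
      s² * + k₁ + α * + m                        ∎

    -- v removes the odd-class term of a³, so that a ⋆ a ⋆ v = s² v
    v : Fun
    v y = + m * a y + - + k₁ * χ true y

    a⋆v≡ : ∀ x → (a ⋆ v) x ≡ + m * (a ⋆ a) x + - + k₁ * (+ k₁ * χ false x)
    a⋆v≡ x = trans (⋆-linearʳ a a (χ true) (+ m) (- + k₁) x)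
                   (cong (λ t → + m * (a ⋆ a) x + - + k₁ * t)
                         (trans (⋆-χ a true supp-a x) (cong (_* χ false x) ∑a)))

    a⋆a⋆v≡ : ∀ x → (a ⋆ (a ⋆ v)) x ≡ + s * + s * v x
    a⋆a⋆v≡ x = begin
      (a ⋆ (a ⋆ v)) x
        ≡⟨ ⋆-congʳ a a⋆v≡ x ⟩
      (a ⋆ (λ y → + m * (a ⋆ a) y + - + k₁ * (+ k₁ * χ false y))) x
        ≡⟨ ⋆-linearʳ a (a ⋆ a) (λ y → + k₁ * χ false y) (+ m) (- + k₁) x ⟩
      + m * a³ x + - + k₁ * (a ⋆ (λ y → + k₁ * χ false y)) x
        ≡⟨ cong (λ t → + m * a³ x + - + k₁ * t) (⋆-scaleʳ a (χ false) (+ k₁) x) ⟩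
      + m * a³ x + - + k₁ * (+ k₁ * (a ⋆ χ false) x)
        ≡⟨ cong₂ (λ u w → + m * u + - + k₁ * (+ k₁ * w))
                 (a³≡ x) (trans (⋆-χ a false supp-a x) (cong (_* χ true x) ∑a)) ⟩
      + m * (s² * a x + α * χ true x) + - + k₁ * (+ k₁ * (+ k₁ * χ true x))
        ≡⟨ expand (+ m) s² (a x) α (χ true x) (+ k₁) ⟩
      + m * s² * a x + α * + m * χ true x - + k₁ * (+ k₁ * + k₁) * χ true x
        ≡⟨ cong (λ t → + m * s² * a x + α * + m * χ true x - t * χ true x) k₁³≡ ⟩
      + m * s² * a x + α * + m * χ true x - (s² * + k₁ + α * + m) * χ true x
        ≡⟨ collect (+ m) s² (a x) α (χ true x) (+ k₁) ⟩
      s² * v x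
        ≡⟨ cong (_* v x) (sym s*s≡s²) ⟩
      + s * + s * v x ∎
      where
      expand : ∀ m s a α χ k →
               m * (s * a + α * χ) + - k * (k * (k * χ)) ≡ m * s * a + α * m * χ - k * (k * k) * χ
      expand = solve-∀
      collect : ∀ m s a α χ k → m * s * a + α * m * χ - (s * k + α * m) * χ ≡ s * (m * a + - k * χ)
      collect = solve-∀

    ±s-eigenvalue : ∀ t → t * t ≡ + s * + s → ¬ t ≡ 0ℤ → IsEigenvalue M t
    ±s-eigenvalue t t²≡s² t≢0 = eigenvalue-from t (λ y → 1ℤ * (a ⋆ v) y + t * v y) x₁ w-x₁
      (⋆-eigen-√ a v t (λ x → trans (a⋆a⋆v≡ x) (cong (_* v x) (sym t²≡s²))))
      where
      supp-v : SupportedIn true v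
      supp-v u pu = trans (cong₂ (λ w c → + m * w + - + k₁ * ⟦ not (c xor true) ⟧) (supp-a u pu) pu)
                          (zeros (+ m) (+ k₁))
        where
        zeros : ∀ m k → m * 0ℤ + - k * 0ℤ ≡ 0ℤ
        zeros = solve-∀
      a⋆v-x₁ : (a ⋆ v) x₁ ≡ 0ℤ
      a⋆v-x₁ = ⋆-supportedIn a v supp-a supp-v x₁ x₁-odd
      m-k₁≢0 : ¬ + m - + k₁ ≡ 0ℤ
      m-k₁≢0 eq = proj₂ k₁≢0×k₁≢m (sym (ℤP.i-j≡0⇒i≡j (+ m) (+ k₁) eq))
      v-x₁ : v x₁ ≡ + m - + k₁
      v-x₁ = trans (cong₂ (λ b c → + m * ⟦ b ⟧ + - + k₁ * ⟦ not (c xor true) ⟧) (proj₂ A-nonempty) x₁-odd)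
                   (tidy (+ m) (+ k₁))
        where
        tidy : ∀ m k → m * 1ℤ + - k * 1ℤ ≡ m - k
        tidy = solve-∀
      w-x₁ : ¬ 1ℤ * (a ⋆ v) x₁ + t * v x₁ ≡ 0ℤ
      w-x₁ eq with i*j≡0⇒i≡0∨j≡0 t {+ m - + k₁} (begin
        t * (+ m - + k₁)                 ≡⟨ sym (+-identityˡ _) ⟩
        1ℤ * 0ℤ + t * (+ m - + k₁)       ≡⟨ cong₂ (λ u w → 1ℤ * u + t * w) (sym a⋆v-x₁) (sym v-x₁) ⟩
        1ℤ * (a ⋆ v) x₁ + t * v x₁       ≡⟨ eq ⟩
        0ℤ                               ∎)
      ... | inj₁ t≡0   = t≢0 t≡0
      ... | inj₂ m-k≡0 = m-k₁≢0 m-k≡0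

    0-eigenvalue : IsEigenvalue M 0ℤ
    0-eigenvalue = eigenvalue-from 0ℤ y₀ u₂ y₀-u₂ λ x →
      *-cancelˡ-≡ (+ 2) ((a ⋆ y₀) x) (0ℤ * y₀ x) (trans (2a⋆y₀≡0 x) (sym (*-zeroʳ (+ 2))))
      where
      u₂ : Fin n
      u₂ = proj₁ B-nonempty
      -- a ⋆ b is a multiple of χ ps, which y₀ cancels
      y₀ : Fun
      y₀ y = + m * b y + - k₂ * χ (not ps) y
      2a⋆y₀≡0 : ∀ x → + 2 * (a ⋆ y₀) x ≡ 0ℤ
      2a⋆y₀≡0 x = begin
        + 2 * (a ⋆ y₀) x
          ≡⟨ cong (+ 2 *_) (⋆-linearʳ a b (χ (not ps)) (+ m) (- k₂) x) ⟩
        + 2 * (+ m * (a ⋆ b) x + - k₂ * (a ⋆ χ (not ps)) x)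
          ≡⟨ cong (λ t → + 2 * (+ m * (a ⋆ b) x + - k₂ * t)) (⋆-χ a (not ps) supp-a x) ⟩
        + 2 * (+ m * (a ⋆ b) x + - k₂ * (sum a * χ (true xor not ps) x))
          ≡⟨ cong₂ (λ u c → + 2 * (+ m * (a ⋆ b) x + - k₂ * (u * χ c x))) ∑a (not-involutive ps) ⟩
        + 2 * (+ m * (a ⋆ b) x + - k₂ * (+ k₁ * χ ps x))
          ≡⟨ expand (+ m) ((a ⋆ b) x) k₂ (+ k₁) (χ ps x) ⟩
        + m * (+ 2 * (a ⋆ b) x) - + 2 * (+ k₁ * k₂) * χ ps x
          ≡⟨ cong₂ (λ u w → + m * u - w * χ ps x) (reflection-part x) 2k₁k₂≡ ⟩
        + m * (+ μ * χ ps x) - + μ * + m * χ ps x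
          ≡⟨ cancel (+ m) (+ μ) (χ ps x) ⟩
        0ℤ ∎
        where
        expand : ∀ m c k₂ k₁ χ → + 2 * (m * c + - k₂ * (k₁ * χ)) ≡ m * (+ 2 * c) - + 2 * (k₁ * k₂) * χ
        expand = solve-∀
        cancel : ∀ m μ χ → m * (μ * χ) - μ * m * χ ≡ 0ℤ
        cancel = solve-∀
      y₀-u₂ : ¬ y₀ u₂ ≡ 0ℤ
      y₀-u₂ eq = proj₂ k₂≢0×k₂≢m (sym (ℤP.i-j≡0⇒i≡j (+ m) k₂ (trans (sym y₀-u₂≡) eq)))
        where
        y₀-u₂≡ : y₀ u₂ ≡ + m - k₂
        y₀-u₂≡ = begin
          + m * b u₂ + - k₂ * ⟦ not (parF u₂ xor not ps) ⟧
            ≡⟨ cong₂ (λ b c → + m * ⟦ b ⟧ + - k₂ * ⟦ not (c xor not ps) ⟧)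
                     (proj₂ B-nonempty) (B-parity u₂ (proj₂ B-nonempty)) ⟩
          + m * 1ℤ + - k₂ * ⟦ not (not ps xor not ps) ⟧
            ≡⟨ cong (λ c → + m * 1ℤ + - k₂ * ⟦ not c ⟧) (xor-same (not ps)) ⟩
          + m * 1ℤ + - k₂ * 1ℤ
            ≡⟨ tidy (+ m) k₂ ⟩
          + m - k₂ ∎
          where
          tidy : ∀ m k → m * 1ℤ + - k * 1ℤ ≡ m - k
          tidy = solve-∀

    spectrum-list : List ℤ
    spectrum-list = + k₁ ∷ - + k₁ ∷ + s ∷ - + s ∷ 0ℤ ∷ []

    s≢0 : ¬ + s ≡ 0ℤ
    s≢0 s≡0 = s²≢0 (trans (sym s*s≡s²) (cong (λ t → t * t) s≡0))

    eigenvalues : All (IsEigenvalue M) spectrum-list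
    eigenvalues = k₁-eigenvalue ∷ -k₁-eigenvalue
                ∷ ±s-eigenvalue (+ s) refl s≢0
                ∷ ±s-eigenvalue (- + s) (neg-sq (+ s)) (s≢0 ∘ neg-injective)
                ∷ 0-eigenvalue ∷ []
      where
      neg-sq : ∀ d → - d * - d ≡ d * d
      neg-sq = solve-∀

    -- Innermost factors first: a (a + s δ)(a - s δ) = a³ - s² a = α χ true, which a + k₁ δ turns
    -- into the constant α k₁, and a - k₁ δ kills constants.

    shiftProduct-0 : ∀ x → shiftProduct a (0ℤ ∷ []) x ≡ a x
    shiftProduct-0 x = begin
      shiftProduct a (0ℤ ∷ []) x    ≡⟨ shift-⋆ a 0ℤ δ x ⟩
      (a ⋆ δ) x - 0ℤ * δ x          ≡⟨ cong (_- 0ℤ * δ x) (⋆-identityʳ a x) ⟩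
      a x - 0ℤ * δ x                ≡⟨ tidy (a x) (δ x) ⟩
      a x                           ∎
      where
      tidy : ∀ p d → p - 0ℤ * d ≡ p
      tidy = solve-∀

    shiftProduct-±s : ∀ x → shiftProduct a (+ s ∷ - + s ∷ 0ℤ ∷ []) x ≡ α * χ true x
    shiftProduct-±s x = begin
      ((λ y → a y - + s * δ y) ⋆ P) x
        ≡⟨ shift-⋆ a (+ s) P x ⟩
      (a ⋆ P) x - + s * P x
        ≡⟨ cong₂ (λ u w → u - + s * w) (trans (⋆-congʳ a P≡ x) (⋆-linearʳ a (a ⋆ a) a 1ℤ (+ s) x)) (P≡ x) ⟩
      1ℤ * a³ x + + s * (a ⋆ a) x - + s * (1ℤ * (a ⋆ a) x + + s * a x)
        ≡⟨ tidy (a³ x) (+ s) ((a ⋆ a) x) (a x) ⟩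
      a³ x - + s * + s * a x
        ≡⟨ cong₂ (λ u w → u - w * a x) (a³≡ x) s*s≡s² ⟩
      s² * a x + α * χ true x - s² * a x
        ≡⟨ cancel (s² * a x) (α * χ true x) ⟩
      α * χ true x ∎
      where
      P : Fun
      P = shiftProduct a (- + s ∷ 0ℤ ∷ [])
      P≡ : ∀ x → P x ≡ 1ℤ * (a ⋆ a) x + + s * a x
      P≡ x = begin
        P x
          ≡⟨ shift-⋆ a (- + s) (shiftProduct a (0ℤ ∷ [])) x ⟩
        (a ⋆ shiftProduct a (0ℤ ∷ [])) x - - + s * shiftProduct a (0ℤ ∷ []) x
          ≡⟨ cong₂ (λ u w → u - - + s * w) (⋆-congʳ a shiftProduct-0 x) (shiftProduct-0 x) ⟩
        (a ⋆ a) x - - + s * a x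
          ≡⟨ flip-sign ((a ⋆ a) x) (+ s) (a x) ⟩
        1ℤ * (a ⋆ a) x + + s * a x ∎
        where
        flip-sign : ∀ c s p → c - - s * p ≡ 1ℤ * c + s * p
        flip-sign = solve-∀
      tidy : ∀ t s c p → 1ℤ * t + s * c - s * (1ℤ * c + s * p) ≡ t - s * s * p
      tidy = solve-∀
      cancel : ∀ u w → u + w - u ≡ w
      cancel = solve-∀

    shiftProduct-k₁ : ∀ x → shiftProduct a (- + k₁ ∷ + s ∷ - + s ∷ 0ℤ ∷ []) x ≡ α * + k₁
    shiftProduct-k₁ x = begin
      ((λ y → a y - - + k₁ * δ y) ⋆ P) x
        ≡⟨ shift-⋆ a (- + k₁) P x ⟩
      (a ⋆ P) x - - + k₁ * P x
        ≡⟨ cong₂ (λ u w → u - - + k₁ * w) (trans (⋆-congʳ a shiftProduct-±s x) (⋆-scaleʳ a (χ true) α x))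
                 (shiftProduct-±s x) ⟩
      α * (a ⋆ χ true) x - - + k₁ * (α * χ true x)
        ≡⟨ cong (λ t → α * t - - + k₁ * (α * χ true x)) (trans (⋆-χ a true supp-a x) (cong (_* χ false x) ∑a)) ⟩
      α * (+ k₁ * χ false x) - - + k₁ * (α * χ true x)
        ≡⟨ factor α (+ k₁) (χ false x) (χ true x) ⟩
      α * + k₁ * (χ false x + χ true x)
        ≡⟨ cong (α * + k₁ *_) (χ-complement x) ⟩
      α * + k₁ * 1ℤ
        ≡⟨ *-identityʳ (α * + k₁) ⟩
      α * + k₁ ∎
      where
      P : Fun
      P = shiftProduct a (+ s ∷ - + s ∷ 0ℤ ∷ [])
      factor : ∀ α k e o → α * (k * e) - - k * (α * o) ≡ α * k * (e + o)
      factor = solve-∀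

    annihilated : ∀ x → shiftProduct a spectrum-list x ≡ 0ℤ
    annihilated x = begin
      shiftProduct a spectrum-list x              ≡⟨ shift-⋆ a (+ k₁) P x ⟩
      (a ⋆ P) x - + k₁ * P x
        ≡⟨ cong₂ (λ u w → u - + k₁ * w) (trans (⋆-congʳ a shiftProduct-k₁ x) (⋆-const a (α * + k₁) x))
                 (shiftProduct-k₁ x) ⟩
      sum a * (α * + k₁) - + k₁ * (α * + k₁)      ≡⟨ cong (λ t → t * (α * + k₁) - + k₁ * (α * + k₁)) ∑a ⟩
      + k₁ * (α * + k₁) - + k₁ * (α * + k₁)       ≡⟨ +-inverseʳ (+ k₁ * (α * + k₁)) ⟩
      0ℤ                                          ∎
      where
      P : Fun
      P = shiftProduct a (- + k₁ ∷ + s ∷ - + s ∷ 0ℤ ∷ [])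

    spectrum : EigenvalueSetIs M spectrum-list
    spectrum = eigenvalues , λ i j →
      trans (prodShift-circulant M a (λ _ _ → refl) spectrum-list i j) (annihilated (i ⊟ j))

module Counting {A : Set} where

  open import Data.List.Relation.Unary.Any using (here; there)

  count-cong : ∀ (xs : List A) {p q : A → Bool} → (∀ x → p x ≡ q x) → count xs p ≡ count xs q
  count-cong []       p≗q = refl
  count-cong (x ∷ xs) {p} {q} p≗q with p x | q x | p≗q x
  ... | true  | true  | _ = cong suc (count-cong xs p≗q)
  ... | false | false | _ = count-cong xs p≗q

  count-mono : ∀ (xs : List A) {p q : A → Bool} → (∀ x → T (q x) → T (p x)) → count xs q ℕ.≤ count xs p
  count-mono []       q⊆p = z≤n
  count-mono (x ∷ xs) {p} {q} q⊆p with q x | p x | q⊆p x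
  ... | true  | true  | _   = s≤s (count-mono xs q⊆p)
  ... | true  | false | q⇒p = ⊥-elim (q⇒p _)
  ... | false | true  | _   = ℕP.m≤n⇒m≤1+n (count-mono xs q⊆p)
  ... | false | false | _   = count-mono xs q⊆p

  count-mono-< : ∀ {xs : List A} {p q : A → Bool} {z} → (∀ x → T (q x) → T (p x)) →
                 z ∈ xs → T (p z) → ¬ T (q z) → count xs q ℕ.< count xs p
  count-mono-< {x ∷ xs} {p} {q} q⊆p (here refl) pz ¬qz with q x | p x | q⊆p x
  ... | true  | _     | _ = ⊥-elim (¬qz _)
  ... | false | true  | _ = s≤s (count-mono xs q⊆p)
  ... | false | false | _ = ⊥-elim pz
  count-mono-< {x ∷ xs} {p} {q} q⊆p (there z∈) pz ¬qz with q x | p x | q⊆p x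
  ... | true  | true  | _   = s≤s (count-mono-< q⊆p z∈ pz ¬qz)
  ... | true  | false | q⇒p = ⊥-elim (q⇒p _)
  ... | false | true  | _   = ℕP.m≤n⇒m≤1+n (count-mono-< q⊆p z∈ pz ¬qz)
  ... | false | false | _   = count-mono-< q⊆p z∈ pz ¬qz

  count-∨ : ∀ (xs : List A) {p q : A → Bool} → (∀ x → T (p x) → ¬ T (q x)) →
            count xs (λ x → p x ∨ q x) ≡ count xs p ℕ.+ count xs q
  count-∨ []       disj = refl
  count-∨ (x ∷ xs) {p} {q} disj with p x | q x | disj x
  ... | true  | true  | pq⇒⊥ = ⊥-elim (pq⇒⊥ _ _)
  ... | true  | false | _ = cong suc (count-∨ xs disj)
  ... | false | true  | _ = trans (cong suc (count-∨ xs disj)) (sym (ℕP.+-suc _ _))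
  ... | false | false | _ = count-∨ xs disj

  count-true : ∀ (xs : List A) p → 1 ℕ.≤ count xs p → Σ A λ x → T (p x)
  count-true (x ∷ xs) p 1≤ with p x in px
  ... | true  = x , subst T (sym px) _
  ... | false = count-true xs p 1≤

  count-false : ∀ (xs : List A) p → (∀ x → ¬ T (p x)) → count xs p ≡ 0
  count-false []       p ¬p = refl
  count-false (x ∷ xs) p ¬p with p x in px
  ... | true  = ⊥-elim (¬p x (subst T (sym px) _))
  ... | false = count-false xs p ¬p

module GraphDistance {V : Set} (allV : List V) (adj eq : V → V → Bool)
  (eq-sound : ∀ {x y} → T (eq x y) → x ≡ y) (eq-refl : ∀ x → T (eq x x))
  (adj-sym : ∀ x y → adj x y ≡ adj y x) (adj-irrefl : ∀ x → ¬ T (adj x x))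
  (complete : ∀ x → x ∈ allV) where

  import Data.List.Relation.Unary.Any as Any
  open import Data.List.Relation.Unary.Any.Properties using (any⁺; any⁻)
  open import Function.Bundles using (Equivalence)
  open Equivalence using (to; from)

  record Walk≤ (i : ℕ) (x y : V) : Set where
    constructor walk≤
    field walk≤-holds : T (reach allV adj eq i x y)

  record Dist (i : ℕ) (x y : V) : Set where
    constructor dist
    field dist-holds : T (distIs allV adj eq i x y)

  open Walk≤
  open Dist

  walk≤-0 : ∀ {x y} → Walk≤ 0 x y → x ≡ y
  walk≤-0 (walk≤ h) = eq-sound h

  walk≤-refl : ∀ x → Walk≤ 0 x x
  walk≤-refl x = walk≤ (eq-refl x)

  walk≤-suc : ∀ {i x y} → Walk≤ i x y → Walk≤ (suc i) x y
  walk≤-suc (walk≤ h) = walk≤ (from BoolP.T-∨ (inj₁ h))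

  walk≤-snoc : ∀ {i x z y} → Walk≤ i x z → T (adj z y) → Walk≤ (suc i) x y
  walk≤-snoc {z = z} (walk≤ h) zy =
    walk≤ (from BoolP.T-∨ (inj₂ (any⁺ _ (Any.map (λ { refl → from BoolP.T-∧ (h , zy) }) (complete z)))))

  walk≤-last : ∀ {i x y} → Walk≤ (suc i) x y → Walk≤ i x y ⊎ Σ V λ z → Walk≤ i x z × T (adj z y)
  walk≤-last {i} {x} {y} (walk≤ h) with to BoolP.T-∨ h
  ... | inj₁ h′ = inj₁ (walk≤ h′)
  ... | inj₂ h′ = let z , hz = Any.satisfied (any⁻ _ allV h′) ; xz , zy = to BoolP.T-∧ hz
                  in  inj₂ (z , walk≤ xz , zy)

  walk≤-cons : ∀ i {y z x} → T (adj y z) → Walk≤ i z x → Walk≤ (suc i) y x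
  walk≤-cons zero {y} yz w with walk≤-0 w
  ... | refl = walk≤-snoc (walk≤-refl y) yz
  walk≤-cons (suc i) yz w with walk≤-last w
  ... | inj₁ w′           = walk≤-suc (walk≤-cons i yz w′)
  ... | inj₂ (u , w′ , ux) = walk≤-snoc (walk≤-cons i yz w′) ux

  walk≤-sym : ∀ i {x y} → Walk≤ i x y → Walk≤ i y x
  walk≤-sym zero    w with walk≤-0 w
  ... | refl = w
  walk≤-sym (suc i) {x} {y} w with walk≤-last w
  ... | inj₁ w′           = walk≤-suc (walk≤-sym i w′)
  ... | inj₂ (z , w′ , zy) = walk≤-cons i (subst T (adj-sym z y) zy) (walk≤-sym i w′)

  walk≤-mono : ∀ {i j x y} → i ℕ.≤ j → Walk≤ i x y → Walk≤ j x y
  walk≤-mono {i} {j} i≤j w with ℕP.≤⇒≤′ i≤j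
  ... | ℕ.≤′-refl     = w
  ... | ℕ.≤′-step i≤′ = walk≤-suc (walk≤-mono (ℕP.≤′⇒≤ i≤′) w)

  dist⇒walk≤ : ∀ i {x y} → Dist i x y → Walk≤ i x y
  dist⇒walk≤ zero    (dist h) = walk≤ h
  dist⇒walk≤ (suc i) (dist h) = walk≤ (proj₁ (to BoolP.T-∧ h))

  dist-0 : ∀ {x y} → Dist 0 x y → x ≡ y
  dist-0 d = walk≤-0 (dist⇒walk≤ 0 d)

  dist-refl : ∀ x → Dist 0 x x
  dist-refl x = dist (eq-refl x)

  dist-minimal : ∀ i {x y} → Dist (suc i) x y → ¬ Walk≤ i x y
  dist-minimal i (dist h) (walk≤ w) = subst T (to BoolP.T-not-≡ (proj₂ (to BoolP.T-∧ h))) w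

  dist-intro : ∀ i {x y} → Walk≤ (suc i) x y → ¬ Walk≤ i x y → Dist (suc i) x y
  dist-intro i {x} {y} (walk≤ w) ¬w = dist (from BoolP.T-∧ (w , ¬T⇒T-not (¬w ∘ walk≤)))
    where
    ¬T⇒T-not : ∀ {b} → ¬ T b → T (not b)
    ¬T⇒T-not {false} _  = _
    ¬T⇒T-not {true}  ¬t = ¬t _

  dist-≤ : ∀ {i j x y} → Walk≤ j x y → Dist i x y → i ℕ.≤ j
  dist-≤ {zero}      w d = z≤n
  dist-≤ {suc i} {j} w d with suc i ℕP.≤? j
  ... | yes i<j = i<j
  ... | no  i≮j = ⊥-elim (dist-minimal i d (walk≤-mono (ℕP.≤-pred (ℕP.≰⇒> i≮j)) w))

  dist-unique : ∀ {i j x y} → Dist i x y → Dist j x y → i ≡ j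
  dist-unique {i} {j} di dj =
    ℕP.≤-antisym (dist-≤ (dist⇒walk≤ j dj) di) (dist-≤ (dist⇒walk≤ i di) dj)

  dist-sym : ∀ i {x y} → Dist i x y → Dist i y x
  dist-sym zero    d with dist-0 d
  ... | refl = d
  dist-sym (suc i) d =
    dist-intro i (walk≤-sym (suc i) (dist⇒walk≤ (suc i) d)) (dist-minimal i d ∘ walk≤-sym i)

  dist-pred : ∀ i {x y} → Dist (suc i) x y → Σ V λ z → Dist i x z × T (adj z y)
  dist-pred i {x} {y} d with walk≤-last (dist⇒walk≤ (suc i) d)
  ... | inj₁ w            = ⊥-elim (dist-minimal i d w)
  ... | inj₂ (z , w , zy) = z , exact i d w zy , zy
    where
    exact : ∀ j {z} → Dist (suc j) x y → Walk≤ j x z → T (adj z y) → Dist j x z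
    exact zero    d w zy = dist (walk≤-holds w)
    exact (suc j) d w zy = dist-intro j w (λ w′ → dist-minimal (suc j) d (walk≤-snoc w′ zy))

  dist-1 : ∀ x y → distIs allV adj eq 1 x y ≡ adj x y
  dist-1 x y = T-ext
    (λ d → let z , d0 , zy = dist-pred 0 (dist d) in subst (λ w → T (adj w y)) (sym (dist-0 d0)) zy)
    (λ xy → dist-holds (dist-intro 0 (walk≤-snoc (walk≤-refl x) xy)
                                      (λ w → adj-irrefl x (subst (λ w → T (adj x w)) (sym (walk≤-0 w)) xy))))

module DistanceRegular {V : Set} (allV : List V) (adj eq : V → V → Bool)
  (eq-sound : ∀ {x y} → T (eq x y) → x ≡ y) (eq-refl : ∀ x → T (eq x x))
  (adj-sym : ∀ x y → adj x y ≡ adj y x) (adj-irrefl : ∀ x → ¬ T (adj x x))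
  (complete : ∀ x → x ∈ allV)
  {k μ : ℕ} (μ<k∸1 : μ ℕ.< k ℕ.∸ 1)
  (DR : IsDistanceRegular allV adj eq 3 (k Vec.∷ k ℕ.∸ 1 Vec.∷ k ℕ.∸ μ Vec.∷ Vec.[])
                                         (1 Vec.∷ μ Vec.∷ k Vec.∷ Vec.[]))
  where

  open GraphDistance allV adj eq eq-sound eq-refl adj-sym adj-irrefl complete public
  open IsDistanceRegular DR
  open Counting
  open import Function.Bundles using (Equivalence)
  open Equivalence using (to; from)

  layer : V → ℕ → V → V → Bool
  layer y j x w = adj x w ∧ distIs allV adj eq j w y

  layer-adj : ∀ y j x w → T (layer y j x w) → T (adj x w)
  layer-adj y j x w = proj₁ ∘ to BoolP.T-∧

  layer-dist : ∀ y j x w → T (layer y j x w) → Dist j w y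
  layer-dist y j x w = dist ∘ proj₂ ∘ to BoolP.T-∧

  b-count : ∀ (i : Fin 3) {x y} → Dist (toℕ i) x y →
            count allV (layer y (suc (toℕ i)) x) ≡ lookup (k Vec.∷ k ℕ.∸ 1 Vec.∷ k ℕ.∸ μ Vec.∷ Vec.[]) i
  b-count i {x} {y} (dist d) = b-ok x y i (to BoolP.T-≡ d)

  c-count : ∀ (i : Fin 3) {x y} → Dist (suc (toℕ i)) x y →
            count allV (layer y (toℕ i) x) ≡ lookup (1 Vec.∷ μ Vec.∷ k Vec.∷ Vec.[]) i
  c-count i {x} {y} (dist d) = c-ok x y i (to BoolP.T-≡ d)

  degree : ∀ x → count allV (adj x) ≡ k
  degree x = trans (count-cong allV (λ w → sym (adj∧dist-1 w))) (b-count F.zero (dist-refl x))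
    where
    adj∧dist-1 : ∀ w → (adj x w ∧ distIs allV adj eq 1 w x) ≡ adj x w
    adj∧dist-1 w rewrite dist-1 w x | adj-sym w x = BoolP.∧-idem (adj x w)

  1≤k : 1 ℕ.≤ k
  1≤k = positive k μ<k∸1
    where
    positive : ∀ k → μ ℕ.< k ℕ.∸ 1 → 1 ℕ.≤ k
    positive (suc k) _ = s≤s z≤n

  μ≤k : μ ℕ.≤ k
  μ≤k = ℕP.≤-trans (ℕP.<⇒≤ μ<k∸1) (ℕP.m∸n≤m k 1)

  dist≤3 : ∀ {i x y} → Dist i x y → i ℕ.≤ 3
  dist≤3 {x = x} {y} d with connected-diam≤ x y
  ... | j , j≤3 , dj = subst (ℕ._≤ 3) (dist-unique (dist (from BoolP.T-≡ dj)) d) j≤3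

  saturated : ∀ x (q : V → Bool) → (∀ w → T (q w) → T (adj x w)) → count allV q ≡ k →
              ∀ z → T (adj x z) → T (q z)
  saturated x q q⊆adj count≡k z xz with q z in qz
  ... | true  = _
  ... | false = ⊥-elim (ℕP.<⇒≢ (count-mono-< q⊆adj (complete z) xz (subst T qz))
                               (trans count≡k (sym (degree x))))

  full-layers : ∀ {x y} j j′ → count allV (λ w → layer y j x w ∨ layer y j′ x w) ≡ k →
                ∀ {i z} → ¬ i ≡ j → ¬ i ≡ j′ → Dist i z y → ¬ T (adj x z)
  full-layers {x} {y} j j′ full i≢j i≢j′ dz xz
    with to BoolP.T-∨ (saturated x _ (λ w → [_,_] (layer-adj y j x w) (layer-adj y j′ x w) ∘ to BoolP.T-∨)
                                 full _ xz)
  ... | inj₁ l = i≢j (dist-unique dz (layer-dist y j x _ l))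
  ... | inj₂ l = i≢j′ (dist-unique dz (layer-dist y j′ x _ l))

  count-layers : ∀ {y x} j j′ → ¬ j ≡ j′ →
                 count allV (λ w → layer y j x w ∨ layer y j′ x w)
                 ≡ count allV (layer y j x) ℕ.+ count allV (layer y j′ x)
  count-layers {y} {x} j j′ j≢j′ =
    count-∨ allV (λ w l l′ → j≢j′ (dist-unique (layer-dist y j x w l) (layer-dist y j′ x w l′)))

  -- a_i = k - b_i - c_i = 0 for every i
  no-edge-in-layer : ∀ i {x z y} → Dist i x y → Dist i z y → ¬ T (adj x z)
  no-edge-in-layer zero dx dz xz with dist-0 dx | dist-0 dz
  ... | refl | refl = adj-irrefl _ xz
  no-edge-in-layer 1 {x} {y = y} dx = full-layers 0 2 (begin
    count allV (λ w → layer y 0 x w ∨ layer y 2 x w)       ≡⟨ count-layers 0 2 (λ ()) ⟩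
    count allV (layer y 0 x) ℕ.+ count allV (layer y 2 x)  ≡⟨ cong₂ ℕ._+_ (c-count F.zero dx) (b-count (F.suc F.zero) dx) ⟩
    1 ℕ.+ (k ℕ.∸ 1)                                        ≡⟨ ℕP.m+[n∸m]≡n 1≤k ⟩
    k                                                      ∎) (λ ()) (λ ())
  no-edge-in-layer 2 {x} {y = y} dx = full-layers 1 3 (begin
    count allV (λ w → layer y 1 x w ∨ layer y 3 x w)       ≡⟨ count-layers 1 3 (λ ()) ⟩
    count allV (layer y 1 x) ℕ.+ count allV (layer y 3 x)
      ≡⟨ cong₂ ℕ._+_ (c-count (F.suc F.zero) dx) (b-count (F.suc (F.suc F.zero)) dx) ⟩
    μ ℕ.+ (k ℕ.∸ μ)                                        ≡⟨ ℕP.m+[n∸m]≡n μ≤k ⟩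
    k                                                      ∎) (λ ()) (λ ())
  no-edge-in-layer 3 {x} {y = y} dx = full-layers 2 2 (begin
    count allV (λ w → layer y 2 x w ∨ layer y 2 x w)       ≡⟨ count-cong allV (λ w → BoolP.∨-idem (layer y 2 x w)) ⟩
    count allV (layer y 2 x)                               ≡⟨ c-count (F.suc (F.suc F.zero)) dx ⟩
    k                                                      ∎) (λ ()) (λ ())
  no-edge-in-layer (suc (suc (suc (suc i)))) dx _ _ with dist≤3 dx
  ... | s≤s (s≤s (s≤s ()))

  distance : V → V → ℕ
  distance x y = proj₁ (connected-diam≤ x y)

  dist-distance : ∀ x y → Dist (distance x y) x y
  dist-distance x y = dist (from BoolP.T-≡ (proj₂ (proj₂ (connected-diam≤ x y))))

  parity-flip : ∀ {i j x z y} → Dist i x y → Dist j z y → T (adj x z) → odd? j ≡ not (odd? i)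
  parity-flip {i} {j} {x} {z} dx dz xz with ℕP.<-cmp i j
  ... | tri≈ _ refl _ = ⊥-elim (no-edge-in-layer i dx dz xz)
  ... | tri< i<j _ _ with ℕP.≤-antisym (dist-≤ (walk≤-cons i (subst T (adj-sym x z) xz) (dist⇒walk≤ i dx)) dz) i<j
  ...   | refl = refl
  parity-flip {i} {j} {x} {z} dx dz xz | tri> _ _ j<i
    with ℕP.≤-antisym (dist-≤ (walk≤-cons j xz (dist⇒walk≤ j dz)) dx) j<i
  ...   | refl = sym (not-involutive (odd? j))

  even-distance : ∀ {i x y} → Dist i x y → odd? i ≡ false → ¬ x ≡ y → Dist 2 x y
  even-distance {i} d even x≢y with dist≤3 d
  ... | z≤n                   = ⊥-elim (x≢y (dist-0 d))
  ... | s≤s z≤n               with even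
  ...   | ()
  even-distance d even x≢y | s≤s (s≤s z≤n)       = d
  even-distance d even x≢y | s≤s (s≤s (s≤s z≤n)) with even
  ...   | ()

  common-neighbours-self : ∀ y → count allV (layer y 1 y) ≡ k
  common-neighbours-self y = b-count F.zero (dist-refl y)

  common-neighbours-even : ∀ {i x y} → Dist i x y → odd? i ≡ false → ¬ x ≡ y → count allV (layer y 1 x) ≡ μ
  common-neighbours-even d even x≢y = c-count (F.suc F.zero) (even-distance d even x≢y)

  common-neighbours-odd : ∀ {i x y} → Dist i x y → odd? i ≡ true → count allV (layer y 1 x) ≡ 0
  common-neighbours-odd {i} {x} {y} d odd = count-false allV (layer y 1 x) λ w l →
    subst T (trans (parity-flip d (layer-dist y 1 x w l) (layer-adj y 1 x w l)) (cong not odd)) _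

module DihedralGroup (m : ℕ) .{{_ : NonZero m}} where

  open Dihedral m
  open CyclicGroup m
  open import Algebra.Bundles using (Group)

  flipIf : Bool → Fin n → Fin n
  flipIf b j = if b then negF j else j

  flipIf-addF : ∀ b j l → flipIf b (addF j l) ≡ addF (flipIf b j) (flipIf b l)
  flipIf-addF true  j l = sym (⁻¹-∙-comm j l)
  flipIf-addF false j l = refl

  flipIf-xor : ∀ b c l → flipIf (b xor c) l ≡ flipIf b (flipIf c l)
  flipIf-xor true  true  l = sym (⁻¹-involutive l)
  flipIf-xor true  false l = refl
  flipIf-xor false c     l = refl

  mul-assoc : ∀ x y z → mul (mul x y) z ≡ mul x (mul y z)
  mul-assoc (i , b) (j , c) (l , d) = cong₂ _,_ (begin
    addF (addF i (flipIf b j)) (flipIf (b xor c) l)         ≡⟨ cong (addF (addF i (flipIf b j))) (flipIf-xor b c l) ⟩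
    addF (addF i (flipIf b j)) (flipIf b (flipIf c l))      ≡⟨ addF-assoc i (flipIf b j) _ ⟩
    addF i (addF (flipIf b j) (flipIf b (flipIf c l)))      ≡⟨ cong (addF i) (sym (flipIf-addF b j (flipIf c l))) ⟩
    addF i (flipIf b (addF j (flipIf c l)))                 ∎) (xor-assoc b c d)

  mul-identityˡ : ∀ x → mul e x ≡ x
  mul-identityˡ (j , c) = cong (_, c) (addF-identityˡ j)

  mul-identityʳ : ∀ x → mul x e ≡ x
  mul-identityʳ (i , b) = cong₂ _,_ (trans (cong (addF i) (flip-0ₙ b)) (addF-identityʳ i)) (xor-identityʳ b)
    where
    flip-0ₙ : ∀ b → flipIf b 0ₙ ≡ 0ₙ
    flip-0ₙ true  = ε⁻¹≈ε
    flip-0ₙ false = refl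

  mul-inverseˡ : ∀ x → mul (inv x) x ≡ e
  mul-inverseˡ (i , false) = cong (_, false) (addF-inverseˡ i)
  mul-inverseˡ (i , true)  = cong (_, false) (addF-inverseʳ i)

  mul-inverseʳ : ∀ x → mul x (inv x) ≡ e
  mul-inverseʳ (i , false) = cong (_, false) (addF-inverseʳ i)
  mul-inverseʳ (i , true)  = cong (_, false) (addF-inverseʳ i)

  dihedral : Group 0ℓ 0ℓ
  dihedral = record
    { isGroup = record
      { isMonoid = record
        { isSemigroup = record
          { isMagma = record { isEquivalence = isEquivalence ; ∙-cong = cong₂ mul }
          ; assoc = mul-assoc }
        ; identity = mul-identityˡ , mul-identityʳ }
      ; inverse = mul-inverseˡ , mul-inverseʳ
      ; ⁻¹-cong = cong inv } }

  open import Algebra.Properties.Group dihedral public using (⁻¹-anti-homo-//; \\-leftDividesˡ; ⁻¹-anti-homo-∙)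
    renaming (ε⁻¹≈ε to inv-e)

  mul-inv-cancelʳ : ∀ x y g → mul (mul x g) (inv (mul y g)) ≡ mul x (inv y)
  mul-inv-cancelʳ x y g = begin
    mul (mul x g) (inv (mul y g))             ≡⟨ cong (mul (mul x g)) (⁻¹-anti-homo-∙ y g) ⟩
    mul (mul x g) (mul (inv g) (inv y))       ≡⟨ mul-assoc x g _ ⟩
    mul x (mul g (mul (inv g) (inv y)))       ≡⟨ cong (mul x) (\\-leftDividesˡ g (inv y)) ⟩
    mul x (inv y)                             ∎

module DihedralCayley (m : ℕ) .{{_ : NonZero m}} where

  open import Data.Integer using (_+_; _*_; _-_)
  open FinSums

  open Dihedral m
  open CyclicGroup m
  open Convolution m
  open ParityClasses m
  open Core m
  open DihedralGroup m
  open import Data.List.Relation.Unary.Any as Any using (here; there)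
  open import Data.List.Membership.Propositional.Properties using (∈-allFin; ∈-concatMap⁺)
  open import Function.Bundles using (Equivalence)
  open Equivalence using (to; from)

  eqD-sound : ∀ {x y} → T (eqD x y) → x ≡ y
  eqD-sound {i , b} {j , c} h with to (BoolP.T-∧ {eqFin i j}) h
  ... | i≡j , b≡c = cong₂ _,_ (eqF⇒≡ i j (to BoolP.T-≡ i≡j)) (bool b c b≡c)
    where
    bool : ∀ b c → T (eqBool b c) → b ≡ c
    bool true  true  _ = refl
    bool false false _ = refl

  eqD-refl : ∀ x → T (eqD x x)
  eqD-refl (i , b) = from BoolP.T-∧ (from BoolP.T-≡ (eqF-refl i) , bool b)
    where
    bool : ∀ b → T (eqBool b b)
    bool true  = _
    bool false = _

  pairs : Fin n → List D
  pairs j = (j , false) ∷ (j , true) ∷ []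

  allD-complete : ∀ x → x ∈ allD
  allD-complete (i , b) = ∈-concatMap⁺ pairs (Any.map (λ { refl → pair b }) (∈-allFin i))
    where
    pair : ∀ b → (i , b) ∈ pairs i
    pair false = here refl
    pair true  = there (here refl)

  count-allD : ∀ (p : D → Bool) → + count allD p ≡ ∑[ i < n ] (⟦ p (i , false) ⟧ + ⟦ p (i , true) ⟧)
  count-allD p = go n id
    where
    go : ∀ M (t : Fin M → Fin n) →
         + count (List.concatMap pairs (tabulate t)) p ≡ ∑[ i < M ] (⟦ p (t i , false) ⟧ + ⟦ p (t i , true) ⟧)
    go zero    t = refl
    go (suc M) t = begin
      + count ((t F.zero , false) ∷ (t F.zero , true) ∷ rest) p        ≡⟨ count-∷ (t F.zero , false) _ p ⟩
      ⟦ p (t F.zero , false) ⟧ + + count ((t F.zero , true) ∷ rest) p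
        ≡⟨ cong (_+_ ⟦ p (t F.zero , false) ⟧) (count-∷ (t F.zero , true) rest p) ⟩
      ⟦ p (t F.zero , false) ⟧ + (⟦ p (t F.zero , true) ⟧ + + count rest p)
        ≡⟨ sym (+-assoc ⟦ p (t F.zero , false) ⟧ _ _) ⟩
      ⟦ p (t F.zero , false) ⟧ + ⟦ p (t F.zero , true) ⟧ + + count rest p
        ≡⟨ cong (_+_ (⟦ p (t F.zero , false) ⟧ + ⟦ p (t F.zero , true) ⟧)) (go M (t ∘ F.suc)) ⟩
      ∑[ i < suc M ] (⟦ p (t i , false) ⟧ + ⟦ p (t i , true) ⟧) ∎
      where
      rest : List D
      rest = List.concatMap pairs (tabulate (t ∘ F.suc))

  module _ (S : D → Bool) (S-e : S e ≡ false) (S-inv : ∀ x → S (inv x) ≡ S x)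
           {k μ : ℕ} (μ<k∸1 : μ ℕ.< k ℕ.∸ 1)
           (DR : IsDistanceRegular allD (cayAdj S) eqD 3 (k Vec.∷ k ℕ.∸ 1 Vec.∷ k ℕ.∸ μ Vec.∷ Vec.[])
                                                        (1 Vec.∷ μ Vec.∷ k Vec.∷ Vec.[]))
    where

    cayAdj-sym : ∀ x y → cayAdj S x y ≡ cayAdj S y x
    cayAdj-sym x y = trans (sym (S-inv (mul x (inv y)))) (cong S (⁻¹-anti-homo-// x y))

    cayAdj-irrefl : ∀ x → ¬ T (cayAdj S x x)
    cayAdj-irrefl x xx = subst T (trans (cong S (mul-inverseʳ x)) S-e) xx

    cayAdj-e : ∀ z → cayAdj S z e ≡ S z
    cayAdj-e z = cong S (trans (cong (mul z) inv-e) (mul-identityʳ z))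

    e-cayAdj : ∀ z → cayAdj S e z ≡ S z
    e-cayAdj z = trans (cayAdj-sym e z) (cayAdj-e z)

    open DistanceRegular allD (cayAdj S) eqD eqD-sound eqD-refl cayAdj-sym cayAdj-irrefl allD-complete μ<k∸1 DR

    colour : D → Bool
    colour x = odd? (distance e x)

    dist-to-e : ∀ x → Dist (distance e x) x e
    dist-to-e x = dist-sym _ (dist-distance e x)

    colour-of : ∀ {i x} → Dist i x e → colour x ≡ odd? i
    colour-of {x = x} d = cong odd? (dist-unique (dist-to-e x) d)

    colour-e : colour e ≡ false
    colour-e = colour-of (dist-refl e)

    colour-adj : ∀ {x z} → T (cayAdj S x z) → colour z ≡ not (colour x)
    colour-adj {x} {z} = parity-flip (dist-to-e x) (dist-to-e z)

    colour-S : ∀ {z} → T (S z) → colour z ≡ true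
    colour-S {z} Sz = trans (colour-adj {e} {z} (subst T (sym (e-cayAdj z)) Sz)) (cong not colour-e)

    -- right multiplication is a graph automorphism, so colouring is a homomorphism D → ℤ₂
    colour-mul : ∀ x g → colour (mul x g) ≡ colour x xor colour g
    colour-mul x g = trans (along (distance e x) (dist-distance e x))
                           (cong (_xor colour g) (sym (colour-of (dist-to-e x))))
      where
      along : ∀ d {x} → Dist d e x → colour (mul x g) ≡ odd? d xor colour g
      along zero    d0 with dist-0 d0
      ... | refl = cong colour (mul-identityˡ g)
      along (suc d) {x} dx = via (dist-pred d dx)
        where
        via : Σ D (λ z → Dist d e z × T (cayAdj S z x)) → colour (mul x g) ≡ odd? (suc d) xor colour g
        via (z , dz , zx) = begin
          colour (mul x g)
            ≡⟨ colour-adj {mul z g} {mul x g} (subst (λ w → T (S w)) (sym (mul-inv-cancelʳ z x g)) zx) ⟩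
          not (colour (mul z g))         ≡⟨ cong not (along d dz) ⟩
          not (odd? d xor colour g)      ≡⟨ not-distribˡ-xor (odd? d) (colour g) ⟩
          not (odd? d) xor colour g      ∎

    r s₀ : D
    r  = (modN 1 , false)
    s₀ = (0ₙ , true)

    colour-rotation : ∀ x → colour (x , false) ≡ colour r ∧ parF x
    colour-rotation x = trans (cong (λ y → colour (y , false)) (sym (modN-toℕ x))) (by-power (toℕ x))
      where
      by-power : ∀ t → colour (modN t , false) ≡ colour r ∧ odd? t
      by-power zero    = trans colour-e (sym (BoolP.∧-zeroʳ (colour r)))
      by-power (suc t) = begin
        colour (modN (suc t) , false)
          ≡⟨ cong (λ y → colour (y , false)) (trans (cong modN (ℕP.+-comm 1 t)) (sym (addF-modN t 1))) ⟩
        colour (mul (modN t , false) r)        ≡⟨ colour-mul (modN t , false) r ⟩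
        colour (modN t , false) xor colour r   ≡⟨ cong (_xor colour r) (by-power t) ⟩
        (colour r ∧ odd? t) xor colour r       ≡⟨ toggle (colour r) (odd? t) ⟩
        colour r ∧ not (odd? t)                ∎
        where
        toggle : ∀ c o → (c ∧ o) xor c ≡ c ∧ not o
        toggle true  true  = refl
        toggle true  false = refl
        toggle false o     = refl

    colour-reflection : ∀ x → colour (x , true) ≡ colour (x , false) xor colour s₀
    colour-reflection x =
      trans (cong (λ y → colour (y , true)) (sym (addF-identityʳ x))) (colour-mul (x , false) s₀)

    Even : D → Set
    Even x = Σ ℕ λ i → (i DivMod.% 2 ≡ 0) × (distIs allD (cayAdj S) eqD i e x ≡ true)

    even⇒colour : ∀ {x} → Even x → colour x ≡ false
    even⇒colour (i , i%2≡0 , d) =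
      trans (colour-of (dist-sym i (dist (from BoolP.T-≡ d)))) (%2≡0⇒odd?≡false i i%2≡0)

    colour⇒even : ∀ {x} → colour x ≡ false → Even x
    colour⇒even {x} c =
      distance e x , odd?≡false⇒%2≡0 (distance e x) c , to BoolP.T-≡ (Dist.dist-holds (dist-distance e x))

    -- if r had even colour, H would be C or all of D
    colour-r : ¬ (∀ x → (Even x → inC x ≡ true) × (inC x ≡ true → Even x)) → colour r ≡ true
    colour-r H≢C = by-r (colour r) refl
      where
      by-r : ∀ c → colour r ≡ c → c ≡ true
      by-r true  _  = refl
      by-r false cr = ⊥-elim (by-s₀ (colour s₀) refl)
        where
        rotation-even : ∀ i → colour (i , false) ≡ false
        rotation-even i = trans (colour-rotation i) (cong (_∧ parF i) cr)

        reflection-s₀ : ∀ i → colour (i , true) ≡ colour s₀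
        reflection-s₀ i = trans (colour-reflection i) (cong (_xor colour s₀) (rotation-even i))

        by-s₀ : ∀ c → colour s₀ ≡ c → ⊥
        by-s₀ true  cs = H≢C H≡C
          where
          H≡C : ∀ x → (Even x → inC x ≡ true) × (inC x ≡ true → Even x)
          H≡C (i , false) = (λ _ → refl) , (λ _ → colour⇒even (rotation-even i))
          H≡C (i , true)  = (λ h → trans (sym (even⇒colour h)) (trans (reflection-s₀ i) cs)) , λ ()
        by-s₀ false cs = BoolP.not-¬ refl (trans (sym (colour-S Sz)) (all-even z))
          where
          all-even : ∀ z → colour z ≡ false
          all-even (i , false) = rotation-even i
          all-even (i , true)  = trans (reflection-s₀ i) cs
          neighbour : Σ D λ z → T (cayAdj S e z)
          neighbour = Counting.count-true allD (cayAdj S e) (subst (1 ℕ.≤_) (sym (degree e)) 1≤k)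
          z : D
          z = proj₁ neighbour
          Sz : T (S z)
          Sz = subst T (e-cayAdj z) (proj₂ neighbour)

    A B : Fin n → Bool
    A x = S (x , false)
    B x = S (x , true)

    ⟦layer⟧ : ∀ g z → ⟦ layer e 1 g z ⟧ ≡ ⟦ S (mul g (inv z)) ⟧ * ⟦ S z ⟧
    ⟦layer⟧ g z = trans (cong (λ c → ⟦ cayAdj S g z ∧ c ⟧) (trans (dist-1 z e) (cayAdj-e z)))
                        (⟦∧⟧ (S (mul g (inv z))) (S z))

    common-neighbours : ∀ g → ¬ g ≡ e → + count allD (layer e 1 g) ≡ + μ * ⟦ not (colour g) ⟧
    common-neighbours g g≢e = by-colour (colour g) refl
      where
      by-colour : ∀ c → colour g ≡ c → + count allD (layer e 1 g) ≡ + μ * ⟦ not c ⟧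
      by-colour true  cg = trans (cong +_ (common-neighbours-odd (dist-to-e g) cg)) (sym (*-zeroʳ (+ μ)))
      by-colour false cg = trans (cong +_ (common-neighbours-even (dist-to-e g) cg g≢e)) (sym (*-identityʳ (+ μ)))

    count-rotation : ∀ t → + count allD (layer e 1 (t , false)) ≡ (𝟙 A ⋆ 𝟙 A) t + (𝟙 B ⋆ 𝟙 (B ∘ negF)) t
    count-rotation t = begin
      + count allD (layer e 1 (t , false))
        ≡⟨ count-allD (layer e 1 (t , false)) ⟩
      ∑[ i < n ] (⟦ layer e 1 (t , false) (i , false) ⟧ + ⟦ layer e 1 (t , false) (i , true) ⟧)
        ≡⟨ ∑-cong (λ i → cong₂ _+_ (⟦layer⟧ (t , false) (i , false)) (⟦layer⟧ (t , false) (i , true))) ⟩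
      ∑[ i < n ] (𝟙 A (t ⊟ i) * 𝟙 A i + 𝟙 B (addF t i) * 𝟙 B i)
        ≡⟨ ∑-distrib-+ (λ i → 𝟙 A (t ⊟ i) * 𝟙 A i) (λ i → 𝟙 B (addF t i) * 𝟙 B i) ⟩
      (𝟙 A ⋆ 𝟙 A) t + ∑[ i < n ] (𝟙 B (addF t i) * 𝟙 B i)
        ≡⟨ cong (_+_ ((𝟙 A ⋆ 𝟙 A) t)) (trans (∑-negate _) (∑-cong reindexed)) ⟨
      (𝟙 A ⋆ 𝟙 A) t + (𝟙 B ⋆ 𝟙 (B ∘ negF)) t ∎
      where
      reindexed : ∀ i → 𝟙 B (t ⊟ negF i) * 𝟙 B (negF (negF i)) ≡ 𝟙 B (addF t i) * 𝟙 B i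
      reindexed i = cong₂ (λ u w → 𝟙 B (addF t u) * 𝟙 B w) (⁻¹-involutive i) (⁻¹-involutive i)

    count-reflection : ∀ t → + count allD (layer e 1 (t , true)) ≡ + 2 * (𝟙 A ⋆ 𝟙 B) t
    count-reflection t = begin
      + count allD (layer e 1 (t , true))
        ≡⟨ count-allD (layer e 1 (t , true)) ⟩
      ∑[ i < n ] (⟦ layer e 1 (t , true) (i , false) ⟧ + ⟦ layer e 1 (t , true) (i , true) ⟧)
        ≡⟨ ∑-cong (λ i → cong₂ _+_ (⟦layer⟧ (t , true) (i , false)) (⟦layer⟧ (t , true) (i , true))) ⟩
      ∑[ i < n ] (𝟙 B (addF t (negF (negF i))) * 𝟙 A i + 𝟙 A (t ⊟ i) * 𝟙 B i)
        ≡⟨ ∑-distrib-+ (λ i → 𝟙 B (addF t (negF (negF i))) * 𝟙 A i) (λ i → 𝟙 A (t ⊟ i) * 𝟙 B i) ⟩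
      ∑[ i < n ] (𝟙 B (addF t (negF (negF i))) * 𝟙 A i) + (𝟙 A ⋆ 𝟙 B) t
        ≡⟨ cong (_+ (𝟙 A ⋆ 𝟙 B) t) (trans (∑-translate _ (negF t)) (∑-cong reindexed)) ⟩
      (𝟙 A ⋆ 𝟙 B) t + (𝟙 A ⋆ 𝟙 B) t
        ≡⟨ double ((𝟙 A ⋆ 𝟙 B) t) ⟩
      + 2 * (𝟙 A ⋆ 𝟙 B) t ∎
      where
      double : ∀ x → x + x ≡ + 2 * x
      double = solve-∀
      reindexed : ∀ w → 𝟙 B (addF t (negF (negF (w ⊟ t)))) * 𝟙 A (w ⊟ t) ≡ 𝟙 A (t ⊟ w) * 𝟙 B w
      reindexed w = begin
        𝟙 B (addF t (negF (negF (w ⊟ t)))) * 𝟙 A (w ⊟ t)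
          ≡⟨ cong₂ (λ u v → 𝟙 B u * ⟦ S (v , false) ⟧)
                   (trans (cong (addF t) (⁻¹-involutive (w ⊟ t))) (trans (addF-comm t _) (//-rightDividesˡ t w)))
                   (sym (⁻¹-anti-homo‿- t w)) ⟩
        𝟙 B w * ⟦ S (inv (t ⊟ w , false)) ⟧
          ≡⟨ cong (λ c → 𝟙 B w * ⟦ c ⟧) (S-inv (t ⊟ w , false)) ⟩
        𝟙 B w * 𝟙 A (t ⊟ w)
          ≡⟨ *-comm (𝟙 B w) _ ⟩
        𝟙 A (t ⊟ w) * 𝟙 B w ∎

    module _ (H≢C : ¬ (∀ x → (Even x → inC x ≡ true) × (inC x ≡ true → Even x))) where

      colour-rotation′ : ∀ x → colour (x , false) ≡ parF x
      colour-rotation′ x = trans (colour-rotation x) (cong (_∧ parF x) (colour-r H≢C))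

      colour-reflection′ : ∀ x → colour (x , true) ≡ parF x xor colour s₀
      colour-reflection′ x = trans (colour-reflection x) (cong (_xor colour s₀) (colour-rotation′ x))

      B-parity : ∀ x → B x ≡ true → parF x ≡ not (colour s₀)
      B-parity x Bx = begin
        parF x                                  ≡⟨ sym (xor-identityʳ (parF x)) ⟩
        parF x xor false                        ≡⟨ cong (parF x xor_) (sym (xor-same (colour s₀))) ⟩
        parF x xor (colour s₀ xor colour s₀)    ≡⟨ sym (xor-assoc (parF x) (colour s₀) (colour s₀)) ⟩
        (parF x xor colour s₀) xor colour s₀
          ≡⟨ cong (_xor colour s₀) (trans (sym (colour-reflection′ x)) (colour-S (from BoolP.T-≡ Bx))) ⟩
        not (colour s₀)                         ∎

      rotation-part : ∀ t → Dec (t ≡ 0ₙ) →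
                      (𝟙 A ⋆ 𝟙 A) t + (𝟙 B ⋆ 𝟙 (B ∘ negF)) t ≡ (+ k - + μ) * δ t + + μ * χ false t
      rotation-part t (yes refl) = begin
        (𝟙 A ⋆ 𝟙 A) 0ₙ + (𝟙 B ⋆ 𝟙 (B ∘ negF)) 0ₙ      ≡⟨ count-rotation 0ₙ ⟨
        + count allD (layer e 1 e)                    ≡⟨ cong +_ (common-neighbours-self e) ⟩
        + k                                           ≡⟨ split (+ k) (+ μ) ⟩
        (+ k - + μ) * 1ℤ + + μ * 1ℤ
          ≡⟨ cong₂ (λ d c → (+ k - + μ) * ⟦ d ⟧ + + μ * ⟦ not (c xor false) ⟧) (sym (eqF-refl 0ₙ)) (sym parF-0ₙ) ⟩
        (+ k - + μ) * δ 0ₙ + + μ * χ false 0ₙ         ∎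
        where
        split : ∀ k μ → k ≡ (k - μ) * 1ℤ + μ * 1ℤ
        split = solve-∀
      rotation-part t (no t≢0) = begin
        (𝟙 A ⋆ 𝟙 A) t + (𝟙 B ⋆ 𝟙 (B ∘ negF)) t       ≡⟨ count-rotation t ⟨
        + count allD (layer e 1 (t , false))         ≡⟨ common-neighbours (t , false) (t≢0 ∘ cong proj₁) ⟩
        + μ * ⟦ not (colour (t , false)) ⟧
          ≡⟨ cong (λ c → + μ * ⟦ not c ⟧) (trans (colour-rotation′ t) (sym (xor-identityʳ (parF t)))) ⟩
        + μ * χ false t                              ≡⟨ +-identityˡ _ ⟨
        0ℤ + + μ * χ false t                         ≡⟨ cong (_+ + μ * χ false t) δ-term ⟨
        (+ k - + μ) * δ t + + μ * χ false t          ∎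
        where
        δ-term : (+ k - + μ) * δ t ≡ 0ℤ
        δ-term = trans (cong (λ d → (+ k - + μ) * ⟦ d ⟧) (eqF-≢ t≢0)) (*-zeroʳ (+ k - + μ))

      reflection-part : ∀ t → + 2 * (𝟙 A ⋆ 𝟙 B) t ≡ + μ * χ (colour s₀) t
      reflection-part t = begin
        + 2 * (𝟙 A ⋆ 𝟙 B) t                          ≡⟨ count-reflection t ⟨
        + count allD (layer e 1 (t , true))          ≡⟨ common-neighbours (t , true) (λ ()) ⟩
        + μ * ⟦ not (colour (t , true)) ⟧            ≡⟨ cong (λ c → + μ * ⟦ not c ⟧) (colour-reflection′ t) ⟩
        + μ * χ (colour s₀) t                        ∎

      square-identity : SquareIdentity A B (colour s₀) k μ
      square-identity = record
        { A-odd           = λ x Ax → trans (sym (colour-rotation′ x)) (colour-S (from BoolP.T-≡ Ax))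
        ; B-parity        = B-parity
        ; A-symmetric     = λ x → S-inv (x , false)
        ; rotation-part   = λ t → rotation-part t (t FinP.≟ 0ₙ)
        ; reflection-part = reflection-part
        ; degree          = begin
            sum (𝟙 A) + sum (𝟙 B)                ≡⟨ ∑-distrib-+ (𝟙 A) (𝟙 B) ⟨
            ∑[ i < n ] (𝟙 A i + 𝟙 B i)           ≡⟨ count-allD S ⟨
            + count allD S                       ≡⟨ cong +_ (trans (Counting.count-cong allD (sym ∘ e-cayAdj)) (degree e)) ⟩
            + k                                  ∎
        }

open import Data.Nat using (_<_; _∸_; _*_)
open import Data.Nat.DivMod using (_%_)

proposition5p2 :
  (m : ℕ) .{{_ : NonZero m}} →
  let open Dihedral m in
  (S : D → Bool) → S e ≡ false → (∀ x → S (inv x) ≡ S x) →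
  (k μ : ℕ) → μ < k ∸ 1 →
  IsDistanceRegular allD (cayAdj S) eqD 3
    (Vec._∷_ k (Vec._∷_ (k ∸ 1) (Vec._∷_ (k ∸ μ) Vec.[])))
    (Vec._∷_ 1 (Vec._∷_ μ (Vec._∷_ k Vec.[]))) →
  let H : D → Set
      H x = Σ ℕ λ i → (i % 2 ≡ 0) × (distIs allD (cayAdj S) eqD i e x ≡ true)
  in
  ¬ (∀ x → (H x → inC x ≡ true) × (inC x ≡ true → H x)) →
  let k₁ = count (allFin n) (λ i → S (i , false))
      k₂ = + k ℤ.- + k₁
  in
  Σ ℕ λ α → Σ ℕ λ β →
    IsIncidenceGraphOfSymPGD (cayAdjC S) m k₁ α β
    × (+ 2 ℤ.* + α ≡ + μ ℤ.* (+ 2 ℤ.* + k₁ ℤ.- k₂))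
    × (+ 2 ℤ.* + k₁ ℤ.- + 1 ℤ.+ + β ℤ.- + α ≡ (+ k₁ ℤ.- k₂) ℤ.* (+ k₁ ℤ.- k₂))
    × ((+ k₁ ℤ.- k₂) ℤ.* (+ k₁ ℤ.- k₂) ≡ + k ℤ.- + μ)
    × (Σ ℕ λ s → (s * s ≡ k ∸ μ)
        × EigenvalueSetIs (adjMat (cayAdjC S))
            (+ k₁ ∷ - (+ k₁) ∷ + s ∷ - (+ s) ∷ + 0 ∷ []))
proposition5p2 m S S-e S-inv k μ μ<k∸1 DR H≢C =
  flags₀ , flags₁ , incidence-graph , 2flags₀≡ , flags-difference , [k₁-k₂]²≡s² , s , s*s≡k∸μ , spectrum
  where
  open DihedralCayley m using (square-identity)
  open Core.Consequences m (square-identity S S-e S-inv μ<k∸1 DR H≢C) μ<k∸1
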